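{- Let $n\ge1$. Then $\gamma_e(P_n)=\left\lceil\frac{n+1}{2}\right\rceil$ if and only if $n\in\{1,6,10\}$.
   Context: $P_n$ is the path on $n$ vertices $[x_1,\dots,x_n]$ with edges $\{x_i,x_{i+1}\}$. For a graph $\Gamma=(V,E)$ with distance $d$: a vertex $v$ carrying a positive integer label $\ell$ dominates exactly the vertices $u$ with $d(u,v)=\ell$; a vertex carrying label $0$ dominates only itself. An extended irregular dominating set is a set $S\subseteq V$ with an injective labeling $\lambda:S\to\{0,1,2,\dots\}$ such that every vertex of $V$ is dominated by some vertex of $S$, where some vertex of $S$ has label $0$. $\gamma_e(\Gamma)$ is the minimum cardinality of such a set (taken to be $+\infty$ if none exists). -}

module Defs where

open import Data.Nat using (ℕ; zero; suc; _+_; _≤_; _/_; ∣_-_∣)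
open import Data.Fin using (Fin; toℕ)
open import Data.Maybe using (Maybe; just; nothing)
open import Data.List using (List; length; filterᵇ; allFin)
open import Data.Maybe using (is-just)
open import Data.Product using (Σ; ∃; ∃-syntax; _×_; _,_)
open import Relation.Binary.PropositionalEquality using (_≡_)

-- The path P_n: vertices Fin n (x_{i+1} ↦ i), distance d(i,j) = |i - j|.
dist : {n : ℕ} → Fin n → Fin n → ℕ
dist i j = ∣ toℕ i - toℕ j ∣

-- A labelled subset of V(P_n): λ v ≡ just ℓ means v ∈ S with label ℓ;
-- λ v ≡ nothing means v ∉ S.
Labelling : ℕ → Set
Labelling n = Fin n → Maybe ℕ

Dominates : {n : ℕ} → ℕ → Fin n → Fin n → Set
Dominates zero    v u = u ≡ v
Dominates (suc ℓ) v u = dist u v ≡ suc ℓ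

record IsExtIrrDom {n : ℕ} (λ' : Labelling n) : Set where
  field
    injective : ∀ (u v : Fin n) (ℓ : ℕ) → λ' u ≡ just ℓ → λ' v ≡ just ℓ → u ≡ v
    hasZero   : ∃[ v ] (λ' v ≡ just 0)
    dominates : ∀ (u : Fin n) → ∃[ v ] ∃[ ℓ ] (λ' v ≡ just ℓ × Dominates ℓ v u)

card : {n : ℕ} → Labelling n → ℕ
card {n} λ' = length (filterᵇ (λ v → is-just (λ' v)) (allFin n))

γe≡ : (n k : ℕ) → Set
γe≡ n k =
  (Σ (Labelling n) λ λ' → IsExtIrrDom λ' × card λ' ≡ k)
  × (∀ (λ' : Labelling n) → IsExtIrrDom λ' → k ≤ card λ')

-- ⌈(n+1)/2⌉ = (n+2)/2 (floor division)
ceilHalfSucc : ℕ → ℕ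
ceilHalfSucc n = (n + 2) / 2

-- Each labelled vertex dominates at most two vertices, and the vertex labelled 0 only itself, so
-- n ≤ 2|S| − 1, which is the lower bound γ_e(P_n) ≥ ⌈(n+1)/2⌉. When |S| = ⌈(n+1)/2⌉ almost every
-- vertex is dominated exactly once, so for every weight h the sum of h over the path equals the sum,
-- over the labelled vertices, of h at the vertices they dominate. A full vertex v, with label s and
-- dominating both v − s and v + s, contributes h(v − s) + h(v + s) = 2h(v) + c·s² when h is quadratic,
-- and k distinct labels have ∑ s² ≥ 1² + ⋯ + k². With h the squared distance from the middle of the
-- path these identities are contradictory unless n = 1 or n ∈ {2, 4, 6, 8, 10, 12}; in the even cases
-- the labels of the full vertices must then be exactly 1, …, k, and n = 2, 4, 8, 12 are excluded by
-- checking the first two moments over all placements of these labels. Explicit labellings realise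
-- n = 1, 6, 10.

module Submission where

open import Defs
open import Data.Nat
open import Data.Nat.Properties
open import Data.Nat.DivMod using (m*n/n≡m; +-distrib-/; m*n%n≡0; m<n*o⇒m/o<n)
open import Data.Nat.Tactic.RingSolver using (solve-∀)
open import Algebra.Properties.CommutativeSemigroup +-commutativeSemigroup using (interchange; xy∙z≈xz∙y; xy∙z≈y∙xz)
open import Data.Fin using (Fin; toℕ; fromℕ<)
import Data.Fin as Fin
open import Data.Fin.Properties using (toℕ<n; fromℕ<-toℕ; toℕ-fromℕ<; all?; any?)
open import Data.Bool using (Bool; true; false; if_then_else_; T; not; _∧_; _∨_)
open import Data.Bool.Properties using (T-∧)
open import Data.List using (length; filterᵇ; tabulate)
open import Data.Maybe using (Maybe; just; nothing; is-just; maybe′)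
open import Data.Maybe.Properties using (just-injective) renaming (≡-dec to ≡-decᴹ)
open import Data.Product using (∃; ∃-syntax; _×_; _,_; proj₁; proj₂)
open import Data.Sum using (_⊎_; inj₁; inj₂; [_,_]′)
open import Data.Vec using (Vec; []; _∷_; lookup)
open import Data.Vec.Relation.Unary.All using (All; []; _∷_) renaming (all? to allᵥ?)
open import Data.Vec.Relation.Unary.AllPairs using ([]; _∷_; allPairs?)
open import Data.Vec.Relation.Unary.Unique.Propositional using (Unique)
open import Function using (_∘_; id)
open import Function.Bundles using (_⇔_; mk⇔; Equivalence)
open import Relation.Binary.PropositionalEquality
open import Relation.Nullary using (Dec; yes; no; ¬_; ¬?; contradiction)
open import Relation.Nullary.Decidable using (isYes; toWitness; toWitnessFalse; map′; _×-dec_; _→-dec_)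
open import Data.Unit using (⊤; tt)
open import Data.Empty using (⊥)

-- Indicators and finite sums

𝟙 : ∀ {p} {P : Set p} → Dec P → ℕ
𝟙 (yes _) = 1
𝟙 (no _)  = 0

𝟙≤1 : ∀ {p} {P : Set p} (d : Dec P) → 𝟙 d ≤ 1
𝟙≤1 (yes _) = ≤-refl
𝟙≤1 (no _)  = z≤n

𝟙-yes : ∀ {p} {P : Set p} (d : Dec P) → P → 𝟙 d ≡ 1
𝟙-yes (yes _) _ = refl
𝟙-yes (no ¬p) p = contradiction p ¬p

𝟙-no : ∀ {p} {P : Set p} (d : Dec P) → ¬ P → 𝟙 d ≡ 0
𝟙-no (yes p) ¬p = contradiction p ¬p
𝟙-no (no _)  _  = refl

1≤𝟙⇒ : ∀ {p} {P : Set p} (d : Dec P) → 1 ≤ 𝟙 d → P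
1≤𝟙⇒ (yes p) _ = p

𝟙just : ∀ {A : Set} → Maybe A → ℕ
𝟙just = maybe′ (λ _ → 1) 0

𝟙just≤1 : ∀ {A : Set} (x : Maybe A) → 𝟙just x ≤ 1
𝟙just≤1 nothing  = z≤n
𝟙just≤1 (just _) = ≤-refl

1≤𝟙just⇒ : ∀ {A : Set} (x : Maybe A) → 1 ≤ 𝟙just x → ∃ λ a → x ≡ just a
1≤𝟙just⇒ (just a) _ = a , refl

∑ : ℕ → (ℕ → ℕ) → ℕ
∑ zero    f = 0
∑ (suc n) f = ∑ n f + f n

syntax ∑ n (λ i → e) = ∑[ i < n ] e

∑-cong : ∀ n {f g : ℕ → ℕ} → (∀ i → i < n → f i ≡ g i) → ∑ n f ≡ ∑ n g
∑-cong zero    eq = refl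
∑-cong (suc n) eq = cong₂ _+_ (∑-cong n λ i i<n → eq i (m<n⇒m<1+n i<n)) (eq n ≤-refl)

∑-mono-≤ : ∀ n {f g : ℕ → ℕ} → (∀ i → i < n → f i ≤ g i) → ∑ n f ≤ ∑ n g
∑-mono-≤ zero    le = z≤n
∑-mono-≤ (suc n) le = +-mono-≤ (∑-mono-≤ n λ i i<n → le i (m<n⇒m<1+n i<n)) (le n ≤-refl)

∑-const : ∀ n c → ∑[ _ < n ] c ≡ n * c
∑-const zero    c = refl
∑-const (suc n) c = trans (cong (_+ c) (∑-const n c)) (+-comm (n * c) c)

∑-zero : ∀ n → ∑[ _ < n ] 0 ≡ 0
∑-zero n = trans (∑-const n 0) (*-zeroʳ n)

∑-+ : ∀ n (f g : ℕ → ℕ) → ∑[ i < n ] (f i + g i) ≡ ∑ n f + ∑ n g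
∑-+ zero    f g = refl
∑-+ (suc n) f g = trans (cong (_+ (f n + g n)) (∑-+ n f g)) (interchange (∑ n f) (∑ n g) (f n) (g n))

∑-*ˡ : ∀ n c (f : ℕ → ℕ) → ∑[ i < n ] (c * f i) ≡ c * ∑ n f
∑-*ˡ zero    c f = sym (*-zeroʳ c)
∑-*ˡ (suc n) c f = trans (cong (_+ c * f n) (∑-*ˡ n c f)) (sym (*-distribˡ-+ c (∑ n f) (f n)))

∑-*ʳ : ∀ n c (f : ℕ → ℕ) → ∑[ i < n ] (f i * c) ≡ ∑ n f * c
∑-*ʳ n c f = trans (∑-cong n λ i _ → *-comm (f i) c) (trans (∑-*ˡ n c f) (*-comm c (∑ n f)))

∑-comm : ∀ n m (f : ℕ → ℕ → ℕ) → ∑[ i < n ] ∑[ j < m ] f i j ≡ ∑[ j < m ] ∑[ i < n ] f i j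
∑-comm zero    m f = sym (∑-zero m)
∑-comm (suc n) m f = trans (cong (_+ ∑ m (f n)) (∑-comm n m f)) (sym (∑-+ m (λ j → ∑[ i < n ] f i j) (f n)))

∑-head : ∀ n (f : ℕ → ℕ) → ∑ (suc n) f ≡ f 0 + ∑[ i < n ] f (suc i)
∑-head zero    f = +-comm 0 (f 0)
∑-head (suc n) f = trans (cong (_+ f (suc n)) (∑-head n f)) (+-assoc (f 0) _ _)

∑-split : ∀ a b (f : ℕ → ℕ) → ∑ (a + b) f ≡ ∑ a f + ∑[ i < b ] f (a + i)
∑-split a zero    f rewrite +-identityʳ a = sym (+-identityʳ (∑ a f))
∑-split a (suc b) f rewrite +-suc a b =
  trans (cong (_+ f (a + b)) (∑-split a b f)) (+-assoc (∑ a f) _ (f (a + b)))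

∑-reverse : ∀ n (f : ℕ → ℕ) → ∑ n f ≡ ∑[ i < n ] f (n ∸ suc i)
∑-reverse zero    f = refl
∑-reverse (suc n) f = begin
  ∑ n f + f n                             ≡⟨ cong (_+ f n) (∑-reverse n f) ⟩
  ∑[ i < n ] f (n ∸ suc i) + f n          ≡⟨ +-comm _ (f n) ⟩
  f n + ∑[ i < n ] f (n ∸ suc i)          ≡⟨ sym (∑-head n (λ i → f (suc n ∸ suc i))) ⟩
  ∑[ i < suc n ] f (suc n ∸ suc i)        ∎
  where open ≡-Reasoning

term≤∑ : ∀ n (f : ℕ → ℕ) {i} → i < n → f i ≤ ∑ n f
term≤∑ (suc n) f {i} i<1+n with m<1+n⇒m<n∨m≡n i<1+n
... | inj₁ i<n  = ≤-trans (term≤∑ n f i<n) (m≤m+n (∑ n f) (f n))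
... | inj₂ refl = m≤n+m (f n) (∑ n f)

∑≡0⇒≡0 : ∀ n (f : ℕ → ℕ) → ∑ n f ≡ 0 → ∀ i → i < n → f i ≡ 0
∑≡0⇒≡0 n f eq i i<n = n≤0⇒n≡0 (subst (f i ≤_) eq (term≤∑ n f i<n))

∑-positive : ∀ n (f : ℕ → ℕ) → 1 ≤ ∑ n f → ∃ λ i → i < n × 1 ≤ f i
∑-positive (suc n) f 1≤Σ with f n in eq
... | suc _ = n , ≤-refl , subst (1 ≤_) (sym eq) (s≤s z≤n)
... | zero with ∑-positive n f (subst (1 ≤_) (+-identityʳ (∑ n f)) 1≤Σ)
...   | i , i<n , 1≤fi = i , m<n⇒m<1+n i<n , 1≤fi

∑-pointwise-antisym : ∀ n {f g : ℕ → ℕ} → (∀ i → i < n → f i ≤ g i) → ∑ n g ≤ ∑ n f →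
                      ∀ i → i < n → f i ≡ g i
∑-pointwise-antisym (suc n) {f} {g} f≤g Σg≤Σf i i<1+n
  with m<1+n⇒m<n∨m≡n i<1+n
... | inj₁ i<n  = ∑-pointwise-antisym n f≤g′ (≤-reflexive (sym Σf≡Σg)) i i<n
  where
  f≤g′ : ∀ j → j < n → f j ≤ g j
  f≤g′ j j<n = f≤g j (m<n⇒m<1+n j<n)
  Σf≡Σg : ∑ n f ≡ ∑ n g
  Σf≡Σg = ≤-antisym (∑-mono-≤ n f≤g′)
            (+-cancelʳ-≤ (f n) (∑ n g) (∑ n f) (≤-trans (+-monoʳ-≤ (∑ n g) (f≤g n ≤-refl)) Σg≤Σf))
... | inj₂ refl = ≤-antisym (f≤g n ≤-refl)
  (+-cancelˡ-≤ (∑ n f) (g n) (f n) (≤-trans (+-monoˡ-≤ (g n) (∑-mono-≤ n λ j j<n → f≤g j (m<n⇒m<1+n j<n))) Σg≤Σf))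

∑-positive-≤n⇒≡1 : ∀ n (f : ℕ → ℕ) → (∀ i → i < n → 1 ≤ f i) → ∑ n f ≤ n → ∀ i → i < n → f i ≡ 1
∑-positive-≤n⇒≡1 n f 1≤f Σf≤n i i<n =
  sym (∑-pointwise-antisym n 1≤f (≤-trans Σf≤n (≤-reflexive (sym (trans (∑-const n 1) (*-identityʳ n))))) i i<n)

∑-point< : ∀ n {a} (h : ℕ → ℕ) → a < n → ∑[ u < n ] (𝟙 (u ≟ a) * h u) ≡ h a
∑-point< (suc n) {a} h a<1+n with m<1+n⇒m<n∨m≡n a<1+n
... | inj₁ a<n = begin
  ∑[ u < n ] (𝟙 (u ≟ a) * h u) + 𝟙 (n ≟ a) * h n
    ≡⟨ cong₂ _+_ (∑-point< n h a<n) (cong (_* h n) (𝟙-no (n ≟ a) λ { refl → <-irrefl refl a<n })) ⟩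
  h a + 0
    ≡⟨ +-identityʳ (h a) ⟩
  h a ∎
  where open ≡-Reasoning
... | inj₂ refl = begin
  ∑[ u < n ] (𝟙 (u ≟ n) * h u) + 𝟙 (n ≟ n) * h n
    ≡⟨ cong₂ _+_ (∑-cong n λ u u<n → cong (_* h u) (𝟙-no (u ≟ n) λ { refl → <-irrefl refl u<n }))
                 (cong (_* h n) (𝟙-yes (n ≟ n) refl)) ⟩
  ∑[ u < n ] 0 + 1 * h n
    ≡⟨ cong₂ _+_ (∑-zero n) (*-identityˡ (h n)) ⟩
  h n ∎
  where open ≡-Reasoning

∑≡1⇒unique : ∀ n (f : ℕ → ℕ) → ∑ n f ≡ 1 →
             ∃ λ i → i < n × f i ≡ 1 × (∀ j → j < n → j ≢ i → f j ≡ 0)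
∑≡1⇒unique (suc n) f Σ≡1 with f n in fn≡
... | zero with ∑≡1⇒unique n f (trans (sym (+-identityʳ (∑ n f))) Σ≡1)
...   | i , i<n , fi≡1 , others = i , m<n⇒m<1+n i<n , fi≡1 , others′
  where
  others′ : ∀ j → j < suc n → j ≢ i → f j ≡ 0
  others′ j j<1+n j≢i with m<1+n⇒m<n∨m≡n j<1+n
  ... | inj₁ j<n  = others j j<n j≢i
  ... | inj₂ refl = fn≡
∑≡1⇒unique (suc n) f Σ≡1 | suc zero = n , ≤-refl , fn≡ , others
  where
  others : ∀ j → j < suc n → j ≢ n → f j ≡ 0
  others j j<1+n j≢n = ∑≡0⇒≡0 n f (+-cancelʳ-≡ 1 (∑ n f) 0 Σ≡1) j (≤∧≢⇒< (≤-pred j<1+n) j≢n)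
∑≡1⇒unique (suc n) f Σ≡1 | suc (suc k) =
  contradiction (suc-injective (trans (sym (+-suc (∑ n f) (suc k))) Σ≡1)) λ e → 1+n≢0 (trans (sym (+-suc (∑ n f) k)) e)

∑-≤1 : ∀ n (f : ℕ → ℕ) → (∀ i → i < n → f i ≤ 1) →
       (∀ i j → i < n → j < n → 1 ≤ f i → 1 ≤ f j → i ≡ j) → ∑ n f ≤ 1
∑-≤1 zero    f _   _      = z≤n
∑-≤1 (suc n) f f≤1 unique with f n in fn≡
... | zero  = subst (_≤ 1) (sym (+-identityʳ (∑ n f)))
                (∑-≤1 n f (λ i i<n → f≤1 i (m<n⇒m<1+n i<n))
                          (λ i j i<n j<n → unique i j (m<n⇒m<1+n i<n) (m<n⇒m<1+n j<n)))
... | suc k = subst (λ s → s + suc k ≤ 1) (sym (trans restZero (∑-zero n))) (subst (_≤ 1) fn≡ (f≤1 n ≤-refl))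
  where
  restZero : ∑ n f ≡ ∑[ _ < n ] 0
  restZero = ∑-cong n λ i i<n → n≤0⇒n≡0 (≮⇒≥ λ 0<fi →
    <-irrefl (unique i n (m<n⇒m<1+n i<n) ≤-refl 0<fi (subst (1 ≤_) (sym fn≡) (s≤s z≤n))) i<n)

∑-excess : ∀ n (f h : ℕ → ℕ) H → (∀ i → i < n → 1 ≤ f i) → ∑ n f ≡ suc n → (∀ i → i < n → h i ≤ H) →
           ∑[ i < n ] (f i * h i) ≤ ∑ n h + H
∑-excess n f h H 1≤f Σf≡ h≤H = begin
  ∑[ i < n ] (f i * h i)
    ≡⟨ ∑-cong n (λ i i<n → cong (_* h i) (sym (m+[n∸m]≡n (1≤f i i<n)))) ⟩
  ∑[ i < n ] (h i + (f i ∸ 1) * h i)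
    ≡⟨ ∑-+ n h (λ i → (f i ∸ 1) * h i) ⟩
  ∑ n h + ∑[ i < n ] ((f i ∸ 1) * h i)
    ≤⟨ +-monoʳ-≤ (∑ n h) (∑-mono-≤ n λ i i<n → *-monoʳ-≤ (f i ∸ 1) (h≤H i i<n)) ⟩
  ∑ n h + ∑[ i < n ] ((f i ∸ 1) * H)
    ≡⟨ cong (∑ n h +_) (trans (∑-*ʳ n H (λ i → f i ∸ 1)) (cong (_* H) excess≡1)) ⟩
  ∑ n h + 1 * H
    ≡⟨ cong (∑ n h +_) (*-identityˡ H) ⟩
  ∑ n h + H ∎
  where
  open ≤-Reasoning
  excess≡1 : ∑[ i < n ] (f i ∸ 1) ≡ 1
  excess≡1 = +-cancelˡ-≡ n _ 1 (begin-equality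
    n + ∑[ i < n ] (f i ∸ 1)             ≡⟨ cong (_+ ∑[ i < n ] (f i ∸ 1)) (sym (trans (∑-const n 1) (*-identityʳ n))) ⟩
    ∑[ _ < n ] 1 + ∑[ i < n ] (f i ∸ 1)  ≡⟨ sym (∑-+ n (λ _ → 1) (λ i → f i ∸ 1)) ⟩
    ∑[ i < n ] (1 + (f i ∸ 1))           ≡⟨ ∑-cong n (λ i i<n → m+[n∸m]≡n (1≤f i i<n)) ⟩
    ∑ n f                                ≡⟨ trans Σf≡ (+-comm 1 n) ⟩
    n + 1                                ∎)

-- If index i carries R i ≤ r items of value f i, their total is at least the sum of the ∑ R
-- smallest admissible values g k, provided the k-th value may be bounded by f b once k < r (b + 1).
∑-packing : ∀ r B (R f g : ℕ → ℕ) → (∀ i → i < B → R i ≤ r) → (∀ b k → k < r * suc b → g k ≤ f b) →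
            ∑ (∑ B R) g ≤ ∑[ i < B ] (R i * f i)
∑-packing r zero    R f g R≤r g≤f = z≤n
∑-packing r (suc B) R f g R≤r g≤f = begin
  ∑ (K + R B) g                              ≡⟨ ∑-split K (R B) g ⟩
  ∑ K g + ∑[ i < R B ] g (K + i)             ≤⟨ +-mono-≤ (∑-packing r B R f g R≤r′ g≤f) lastBlock ⟩
  ∑[ i < B ] (R i * f i) + R B * f B         ∎
  where
  open ≤-Reasoning
  K : ℕ
  K = ∑ B R
  R≤r′ : ∀ i → i < B → R i ≤ r
  R≤r′ i i<B = R≤r i (m<n⇒m<1+n i<B)
  K+i< : ∀ i → i < R B → K + i < r * suc B
  K+i< i i<RB = begin-strict
    K + i       <⟨ +-mono-≤-< (≤-trans (∑-mono-≤ B R≤r′) (≤-reflexive (∑-const B r))) i<RB ⟩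
    B * r + R B ≤⟨ +-monoʳ-≤ (B * r) (R≤r B ≤-refl) ⟩
    B * r + r   ≡⟨ +-comm (B * r) r ⟩
    r + B * r   ≡⟨ *-comm (suc B) r ⟩
    r * suc B   ∎
  lastBlock : ∑[ i < R B ] g (K + i) ≤ R B * f B
  lastBlock = ≤-trans (∑-mono-≤ (R B) λ i i<RB → g≤f B (K + i) (K+i< i i<RB)) (≤-reflexive (∑-const (R B) (f B)))

∑-point : ∀ n a (h : ℕ → ℕ) → ∑[ u < n ] (𝟙 (u ≟ a) * h u) ≡ 𝟙 (a <? n) * h a
∑-point n a h with a <? n
... | yes a<n = trans (∑-point< n h a<n) (sym (+-identityʳ (h a)))
... | no  a≮n = trans (∑-cong n λ u u<n → cong (_* h u) (𝟙-no (u ≟ a) λ { refl → a≮n u<n })) (∑-zero n)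

∑-except : ∀ n {v₀} (f g : ℕ → ℕ) → v₀ < n → (∀ v → v < n → v ≢ v₀ → f v ≡ g v) →
           ∑ n f + g v₀ ≡ ∑ n g + f v₀
∑-except (suc n) {v₀} f g v₀<1+n f≡g with m<1+n⇒m<n∨m≡n v₀<1+n
... | inj₁ v₀<n = begin
  ∑ n f + f n + g v₀   ≡⟨ xy∙z≈xz∙y (∑ n f) (f n) (g v₀) ⟩
  ∑ n f + g v₀ + f n   ≡⟨ cong₂ _+_ (∑-except n f g v₀<n λ v v<n → f≡g v (m<n⇒m<1+n v<n))
                                     (f≡g n ≤-refl λ { refl → <-irrefl refl v₀<n }) ⟩
  ∑ n g + f v₀ + g n   ≡⟨ xy∙z≈xz∙y (∑ n g) (f v₀) (g n) ⟩
  ∑ n g + g n + f v₀   ∎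
  where open ≡-Reasoning
... | inj₂ refl = begin
  ∑ n f + f n + g n    ≡⟨ cong (λ a → a + f n + g n)
                                (∑-cong n λ v v<n → f≡g v (m<n⇒m<1+n v<n) λ { refl → <-irrefl refl v<n }) ⟩
  ∑ n g + f n + g n    ≡⟨ xy∙z≈xz∙y (∑ n g) (f n) (g n) ⟩
  ∑ n g + g n + f n    ∎
  where open ≡-Reasoning

-- Squared distances and sums of squares

distSq : ℕ → ℕ → ℕ
distSq x y = ∣ x - y ∣ * ∣ x - y ∣

distSq-comm : ∀ x y → distSq x y ≡ distSq y x
distSq-comm x y = cong (λ d → d * d) (∣-∣-comm x y)

distSq+2xy-≤ : ∀ {x y} → x ≤ y → distSq x y + 2 * (x * y) ≡ x * x + y * y
distSq+2xy-≤ {x} {y} x≤y = subst (λ y → distSq x y + 2 * (x * y) ≡ x * x + y * y) (m+[n∸m]≡n x≤y) (upward (y ∸ x))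
  where
  identity : ∀ x d → d * d + 2 * (x * (x + d)) ≡ x * x + (x + d) * (x + d)
  identity = solve-∀
  upward : ∀ d → distSq x (x + d) + 2 * (x * (x + d)) ≡ x * x + (x + d) * (x + d)
  upward d rewrite ∣m-m+n∣≡n x d = identity x d

distSq+2xy : ∀ x y → distSq x y + 2 * (x * y) ≡ x * x + y * y
distSq+2xy x y with ≤-total x y
... | inj₁ x≤y = distSq+2xy-≤ x≤y
... | inj₂ y≤x = begin
  distSq x y + 2 * (x * y) ≡⟨ cong₂ (λ a b → a + 2 * b) (distSq-comm x y) (*-comm x y) ⟩
  distSq y x + 2 * (y * x) ≡⟨ distSq+2xy-≤ y≤x ⟩
  y * y + x * x            ≡⟨ +-comm (y * y) (x * x) ⟩
  x * x + y * y            ∎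
  where open ≡-Reasoning

distSq-parallelogram : ∀ X e Y → e ≤ X → distSq (X ∸ e) Y + distSq (X + e) Y ≡ 2 * distSq X Y + 2 * (e * e)
distSq-parallelogram X e Y e≤X =
  subst (λ X → distSq (X ∸ e) Y + distSq (X + e) Y ≡ 2 * distSq X Y + 2 * (e * e)) (m∸n+n≡m e≤X)
        (subst (λ a → distSq a Y + distSq (X ∸ e + e + e) Y ≡ 2 * distSq (X ∸ e + e) Y + 2 * (e * e))
               (sym (m+n∸n≡m (X ∸ e) e)) (shifted (X ∸ e)))
  where
  regroup₁ : ∀ a b x e Y → (a + b) + 4 * ((x + e) * Y) ≡ (a + 2 * (x * Y)) + (b + 2 * ((x + e + e) * Y))
  regroup₁ = solve-∀
  squares : ∀ x e Y → (x * x + Y * Y) + ((x + e + e) * (x + e + e) + Y * Y) ≡ 2 * ((x + e) * (x + e) + Y * Y) + 2 * (e * e)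
  squares = solve-∀
  regroup₂ : ∀ c e x Y → 2 * (c + 2 * ((x + e) * Y)) + 2 * (e * e) ≡ (2 * c + 2 * (e * e)) + 4 * ((x + e) * Y)
  regroup₂ = solve-∀
  shifted : ∀ x → distSq x Y + distSq (x + e + e) Y ≡ 2 * distSq (x + e) Y + 2 * (e * e)
  shifted x = +-cancelʳ-≡ (4 * ((x + e) * Y)) _ _ (begin
    (distSq x Y + distSq (x + e + e) Y) + 4 * ((x + e) * Y)
      ≡⟨ regroup₁ (distSq x Y) (distSq (x + e + e) Y) x e Y ⟩
    (distSq x Y + 2 * (x * Y)) + (distSq (x + e + e) Y + 2 * ((x + e + e) * Y))
      ≡⟨ cong₂ _+_ (distSq+2xy x Y) (distSq+2xy (x + e + e) Y) ⟩
    (x * x + Y * Y) + ((x + e + e) * (x + e + e) + Y * Y)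
      ≡⟨ squares x e Y ⟩
    2 * ((x + e) * (x + e) + Y * Y) + 2 * (e * e)
      ≡⟨ cong (λ c → 2 * c + 2 * (e * e)) (sym (distSq+2xy (x + e) Y)) ⟩
    2 * (distSq (x + e) Y + 2 * ((x + e) * Y)) + 2 * (e * e)
      ≡⟨ regroup₂ (distSq (x + e) Y) e x Y ⟩
    (2 * distSq (x + e) Y + 2 * (e * e)) + 4 * ((x + e) * Y) ∎)
    where open ≡-Reasoning

distSq≡0⇒≡ : ∀ {x y} → distSq x y ≡ 0 → x ≡ y
distSq≡0⇒≡ {x} {y} eq with m*n≡0⇒m≡0∨n≡0 ∣ x - y ∣ eq
... | inj₁ d≡0 = ∣m-n∣≡0⇒m≡n d≡0
... | inj₂ d≡0 = ∣m-n∣≡0⇒m≡n d≡0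

sumSquares : ℕ → ℕ
sumSquares K = ∑[ j < K ] (suc j * suc j)

oddSquare : ℕ → ℕ
oddSquare j = suc (2 * j) * suc (2 * j)

sumOddSquares : ℕ → ℕ
sumOddSquares m = ∑ m oddSquare

-- the K smallest values of gapWeight m (for K ≤ 2m)
pairedOddSquares : ℕ → ℕ
pairedOddSquares K = ∑[ i < K ] oddSquare ⌊ i /2⌋

6*sumSquares : ∀ m → 6 * sumSquares m ≡ m * suc m * suc (2 * m)
6*sumSquares zero    = refl
6*sumSquares (suc m) = begin
  6 * (sumSquares m + suc m * suc m)                ≡⟨ *-distribˡ-+ 6 (sumSquares m) _ ⟩
  6 * sumSquares m + 6 * (suc m * suc m)            ≡⟨ cong (_+ 6 * (suc m * suc m)) (6*sumSquares m) ⟩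
  m * suc m * suc (2 * m) + 6 * (suc m * suc m)     ≡⟨ step m ⟩
  suc m * suc (suc m) * suc (2 * suc m)             ∎
  where
  open ≡-Reasoning
  step : ∀ m → m * suc m * suc (2 * m) + 6 * (suc m * suc m) ≡ suc m * suc (suc m) * suc (2 * suc m)
  step = solve-∀

3*sumOddSquares : ∀ m → 3 * sumOddSquares m + m ≡ 4 * (m * m * m)
3*sumOddSquares zero    = refl
3*sumOddSquares (suc m) = begin
  3 * (sumOddSquares m + oddSquare m) + suc m      ≡⟨ regroup (sumOddSquares m) m ⟩
  (3 * sumOddSquares m + m) + (3 * oddSquare m + 1) ≡⟨ cong (_+ (3 * oddSquare m + 1)) (3*sumOddSquares m) ⟩
  4 * (m * m * m) + (3 * oddSquare m + 1)          ≡⟨ step m ⟩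
  4 * (suc m * suc m * suc m)                      ∎
  where
  open ≡-Reasoning
  regroup : ∀ a m → 3 * (a + suc (2 * m) * suc (2 * m)) + suc m ≡ (3 * a + m) + (3 * (suc (2 * m) * suc (2 * m)) + 1)
  regroup = solve-∀
  step : ∀ m → 4 * (m * m * m) + (3 * (suc (2 * m) * suc (2 * m)) + 1) ≡ 4 * (suc m * suc m * suc m)
  step = solve-∀

∑-distSq-centre : ∀ m → ∑[ u < suc (m + m) ] distSq u m ≡ sumSquares m + sumSquares m
∑-distSq-centre m = begin
  ∑ (suc (m + m)) h                                         ≡⟨ cong (λ n → ∑ n h) (sym (+-suc m m)) ⟩
  ∑ (m + suc m) h                                           ≡⟨ ∑-split m (suc m) h ⟩
  ∑ m h + ∑[ i < suc m ] h (m + i)                          ≡⟨ cong₂ _+_ (∑-reverse m h) (∑-head m (λ i → h (m + i))) ⟩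
  ∑[ j < m ] h (m ∸ suc j) + (h (m + 0) + ∑[ i < m ] h (m + suc i))
    ≡⟨ cong₂ _+_ (∑-cong m λ j j<m → left j j<m) (cong₂ _+_ (offset 0) (∑-cong m λ i _ → offset (suc i))) ⟩
  sumSquares m + (0 + sumSquares m)                         ∎
  where
  open ≡-Reasoning
  h : ℕ → ℕ
  h u = distSq u m
  left : ∀ j → j < m → h (m ∸ suc j) ≡ suc j * suc j
  left j j<m = cong (λ d → d * d) (trans (m≤n⇒∣m-n∣≡n∸m (m∸n≤m m (suc j))) (m∸[m∸n]≡n j<m))
  offset : ∀ i → h (m + i) ≡ i * i
  offset i = cong (λ d → d * d) (trans (∣-∣-comm (m + i) m) (∣m-m+n∣≡n m i))

∑-fold : ∀ m (f : ℕ → ℕ) → ∑ (m + m) f ≡ ∑[ j < m ] (f (m ∸ suc j) + f (m + j))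
∑-fold m f = begin
  ∑ (m + m) f                                          ≡⟨ ∑-split m m f ⟩
  ∑ m f + ∑[ j < m ] f (m + j)                         ≡⟨ cong (_+ ∑[ j < m ] f (m + j)) (∑-reverse m f) ⟩
  ∑[ j < m ] f (m ∸ suc j) + ∑[ j < m ] f (m + j)      ≡⟨ sym (∑-+ m (λ j → f (m ∸ suc j)) (λ j → f (m + j))) ⟩
  ∑[ j < m ] (f (m ∸ suc j) + f (m + j))               ∎
  where open ≡-Reasoning

-- (2u + 1 − 2m)², four times the squared distance of u from the midpoint m − ½ of the path on 2m vertices
gapWeight : ℕ → ℕ → ℕ
gapWeight m u = distSq (suc (2 * u)) (2 * m)

gapWeight-left : ∀ m j → j < m → gapWeight m (m ∸ suc j) ≡ oddSquare j
gapWeight-left m j j<m = cong (λ d → d * d) (begin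
  ∣ suc (2 * r) - 2 * m ∣                     ≡⟨ cong (∣ suc (2 * r) -_∣) 2m≡ ⟩
  ∣ suc (2 * r) - suc (2 * r) + suc (2 * j) ∣ ≡⟨ ∣m-m+n∣≡n (suc (2 * r)) (suc (2 * j)) ⟩
  suc (2 * j)                                 ∎)
  where
  open ≡-Reasoning
  r : ℕ
  r = m ∸ suc j
  split : ∀ r j → 2 * (r + suc j) ≡ suc (2 * r) + suc (2 * j)
  split = solve-∀
  2m≡ : 2 * m ≡ suc (2 * r) + suc (2 * j)
  2m≡ = trans (cong (2 *_) (sym (m∸n+n≡m j<m))) (split r j)

gapWeight-right : ∀ m j → gapWeight m (m + j) ≡ oddSquare j
gapWeight-right m j = cong (λ d → d * d) (begin
  ∣ suc (2 * (m + j)) - 2 * m ∣       ≡⟨ cong (∣_- 2 * m ∣) (split m j) ⟩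
  ∣ 2 * m + suc (2 * j) - 2 * m ∣     ≡⟨ ∣-∣-comm (2 * m + suc (2 * j)) (2 * m) ⟩
  ∣ 2 * m - 2 * m + suc (2 * j) ∣     ≡⟨ ∣m-m+n∣≡n (2 * m) (suc (2 * j)) ⟩
  suc (2 * j)                         ∎)
  where
  open ≡-Reasoning
  split : ∀ m j → suc (2 * (m + j)) ≡ 2 * m + suc (2 * j)
  split = solve-∀

∑-gapWeight : ∀ m → ∑ (m + m) (gapWeight m) ≡ sumOddSquares m + sumOddSquares m
∑-gapWeight m = trans (∑-fold m (gapWeight m))
  (trans (∑-cong m λ j j<m → cong₂ _+_ (gapWeight-left m j j<m) (gapWeight-right m j)) (∑-+ m oddSquare oddSquare))

gapWeight-parallelogram : ∀ m v t → t ≤ v → gapWeight m (v ∸ t) + gapWeight m (v + t) ≡ 2 * gapWeight m v + 8 * (t * t)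
gapWeight-parallelogram m v t t≤v = begin
  gapWeight m (v ∸ t) + gapWeight m (v + t)
    ≡⟨ cong₂ (λ a b → distSq a (2 * m) + distSq b (2 * m)) left right ⟩
  distSq (suc (2 * v) ∸ 2 * t) (2 * m) + distSq (suc (2 * v) + 2 * t) (2 * m)
    ≡⟨ distSq-parallelogram (suc (2 * v)) (2 * t) (2 * m) (m≤n⇒m≤1+n (*-monoʳ-≤ 2 t≤v)) ⟩
  2 * gapWeight m v + 2 * (2 * t * (2 * t))
    ≡⟨ cong (2 * gapWeight m v +_) (scale t) ⟩
  2 * gapWeight m v + 8 * (t * t) ∎
  where
  open ≡-Reasoning
  left : suc (2 * (v ∸ t)) ≡ suc (2 * v) ∸ 2 * t
  left = trans (cong suc (*-distribˡ-∸ 2 v t)) (sym (+-∸-assoc 1 (*-monoʳ-≤ 2 t≤v)))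
  right : suc (2 * (v + t)) ≡ suc (2 * v) + 2 * t
  right = cong suc (*-distribˡ-+ 2 v t)
  scale : ∀ t → 2 * (2 * t * (2 * t)) ≡ 8 * (t * t)
  scale = solve-∀

1≤gapWeight : ∀ m u → 1 ≤ gapWeight m u
1≤gapWeight m u with ∣ suc (2 * u) - 2 * m ∣ in eq
... | zero  = contradiction (sym (∣m-n∣≡0⇒m≡n eq)) (even≢odd m u)
... | suc d = s≤s z≤n

gapWeight≤ : ∀ k u → u < suc k + suc k → gapWeight (suc k) u ≤ oddSquare k
gapWeight≤ k u u< = *-mono-≤ d≤ d≤
  where
  two : ∀ k → 2 * suc k ≡ suc (suc (2 * k))
  two = solve-∀
  d≤ : ∣ suc (2 * u) - 2 * suc k ∣ ≤ suc (2 * k)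
  d≤ with ≤-total (suc (2 * u)) (2 * suc k)
  ... | inj₁ x≤y = subst (_≤ suc (2 * k)) (sym (m≤n⇒∣m-n∣≡n∸m x≤y))
                     (≤-trans (∸-monoʳ-≤ {1} {suc (2 * u)} (2 * suc k) (s≤s z≤n)) (≤-reflexive (cong (_∸ 1) (two k))))
  ... | inj₂ y≤x = subst (_≤ suc (2 * k)) (sym (m≤n⇒∣n-m∣≡n∸m y≤x)) (m≤n+o⇒m∸n≤o (suc (2 * u)) (2 * suc k) le)
    where
    double : ∀ k → suc k + suc k ≡ suc (suc (2 * k))
    double = solve-∀
    bound : ∀ k → suc (2 * suc (2 * k)) ≡ 2 * suc k + suc (2 * k)
    bound = solve-∀
    le : suc (2 * u) ≤ 2 * suc k + suc (2 * k)
    le = ≤-trans (s≤s (*-monoʳ-≤ 2 (≤-pred (subst (u <_) (double k) u<)))) (≤-reflexive (bound k))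

⌊k/2⌋≤ : ∀ b k → k < 2 * suc b → ⌊ k /2⌋ ≤ b
⌊k/2⌋≤ b             zero          _ = z≤n
⌊k/2⌋≤ b             (suc zero)    _ = z≤n
⌊k/2⌋≤ zero          (suc (suc k)) (s≤s (s≤s ()))
⌊k/2⌋≤ (suc b)       (suc (suc k)) k< = s≤s (⌊k/2⌋≤ b k (≤-pred (≤-pred (subst (suc (suc (suc k)) ≤_) (two b) k<))))
  where
  two : ∀ b → 2 * suc (suc b) ≡ suc (suc (2 * suc b))
  two = solve-∀

∑-gapWeight-≥ : ∀ m (P : ℕ → ℕ) → (∀ v → v < m + m → P v ≤ 1) →
                pairedOddSquares (∑ (m + m) P) ≤ ∑[ v < m + m ] (P v * gapWeight m v)
∑-gapWeight-≥ m P P≤1 = subst₂ (λ a b → pairedOddSquares a ≤ b) (sym (∑-fold m P)) (sym folded)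
  (∑-packing 2 m R oddSquare (λ i → oddSquare ⌊ i /2⌋) R≤2
    (λ b k k< → let h = s≤s (*-monoʳ-≤ 2 (⌊k/2⌋≤ b k k<)) in *-mono-≤ h h))
  where
  R : ℕ → ℕ
  R j = P (m ∸ suc j) + P (m + j)
  folded : ∑[ v < m + m ] (P v * gapWeight m v) ≡ ∑[ j < m ] (R j * oddSquare j)
  folded = trans (∑-fold m (λ v → P v * gapWeight m v)) (∑-cong m λ j j<m →
    trans (cong₂ (λ a b → P (m ∸ suc j) * a + P (m + j) * b) (gapWeight-left m j j<m) (gapWeight-right m j))
          (sym (*-distribʳ-+ (oddSquare j) (P (m ∸ suc j)) (P (m + j)))))
  R≤2 : ∀ j → j < m → R j ≤ 2
  R≤2 j j<m = +-mono-≤ (P≤1 (m ∸ suc j) (<-≤-trans (∸-monoʳ-< z<s j<m) (m≤m+n m m)))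
                       (P≤1 (m + j) (+-monoʳ-< m j<m))

8*sumSquares> : ∀ k → 8 * sumSquares (suc k) ≰ (sumOddSquares (suc k) + sumOddSquares (suc k)) + oddSquare k
8*sumSquares> k le = contradiction (+-cancelˡ-≤ X (15 + 18 * k) 0 (begin
  X + (15 + 18 * k)  ≡⟨ excess ⟩
  3 * (8 * S)        ≤⟨ *-monoʳ-≤ 3 le ⟩
  X                  ≡⟨ +-identityʳ X ⟨
  X + 0              ∎)) λ ()
  where
  open ≤-Reasoning
  m A S X : ℕ
  m = suc k
  A = sumOddSquares m
  S = sumSquares m
  X = 3 * (A + A + oddSquare k)
  regroup : ∀ a k → 3 * (a + a + suc (2 * k) * suc (2 * k)) + (15 + 18 * k) + 2 * suc k
                    ≡ 2 * (3 * a + suc k) + 3 * (suc (2 * k) * suc (2 * k)) + (15 + 18 * k)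
  regroup = solve-∀
  cubic : ∀ k → 2 * (4 * (suc k * suc k * suc k)) + 3 * (suc (2 * k) * suc (2 * k)) + (15 + 18 * k)
                ≡ 4 * (suc k * suc (suc k) * suc (2 * suc k)) + 2 * suc k
  cubic = solve-∀
  rescale : ∀ t → 4 * (6 * t) ≡ 3 * (8 * t)
  rescale = solve-∀
  excess : X + (15 + 18 * k) ≡ 3 * (8 * S)
  excess = +-cancelʳ-≡ (2 * m) _ _ (begin-equality
    X + (15 + 18 * k) + 2 * m                        ≡⟨ regroup A k ⟩
    2 * (3 * A + m) + 3 * oddSquare k + (15 + 18 * k) ≡⟨ cong (λ a → 2 * a + 3 * oddSquare k + (15 + 18 * k)) (3*sumOddSquares m) ⟩
    2 * (4 * (m * m * m)) + 3 * oddSquare k + (15 + 18 * k) ≡⟨ cubic k ⟩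
    4 * (m * suc m * suc (2 * m)) + 2 * m            ≡⟨ cong (λ t → 4 * t + 2 * m) (6*sumSquares m) ⟨
    4 * (6 * S) + 2 * m                              ≡⟨ cong (_+ 2 * m) (rescale S) ⟩
    3 * (8 * S) + 2 * m                              ∎)

-- What the moments of gapWeight allow when the path on 2k + 2 vertices is dominated exactly once,
-- Y being a lower bound for the sum of the squared labels of the full vertices.
ExactCoverFeasible : ℕ → ℕ → Set
ExactCoverFeasible k Y = pairedOddSquares k + pairedOddSquares (suc k) + 1 + 8 * Y ≤ sumOddSquares (suc k) + sumOddSquares (suc k)

i≤1+2⌊i/2⌋ : ∀ i → i ≤ suc (2 * ⌊ i /2⌋)
i≤1+2⌊i/2⌋ zero          = z≤n
i≤1+2⌊i/2⌋ (suc zero)    = s≤s z≤n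
i≤1+2⌊i/2⌋ (suc (suc i)) = ≤-trans (s≤s (s≤s (i≤1+2⌊i/2⌋ i))) (≤-reflexive (two ⌊ i /2⌋))
  where
  two : ∀ x → suc (suc (suc (2 * x))) ≡ suc (2 * suc x)
  two = solve-∀

i*i≤oddSquare⌊i/2⌋ : ∀ i → i * i ≤ oddSquare ⌊ i /2⌋
i*i≤oddSquare⌊i/2⌋ i = *-mono-≤ (i≤1+2⌊i/2⌋ i) (i≤1+2⌊i/2⌋ i)

exactCover-infeasible-6+ : ∀ t → let k = 6 + t in
  sumOddSquares (suc k) + sumOddSquares (suc k) <
  pairedOddSquares k + pairedOddSquares (suc k) + 1 + 8 * sumSquares k
exactCover-infeasible-6+ zero    = toWitness {a? = _ <? _} tt
exactCover-infeasible-6+ (suc t) = begin-strict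
  (a + f) + (a + f)                                ≡⟨ regroup₁ a f ⟩
  (a + a) + 2 * f                                  <⟨ +-mono-<-≤ (exactCover-infeasible-6+ t) step ⟩
  (q₆ + q₇ + 1 + 8 * t₆) + (x₆ + x₇ + 8 * (s * s)) ≡⟨ regroup₂ q₆ q₇ t₆ x₆ x₇ (s * s) ⟩
  (q₆ + x₆) + (q₇ + x₇) + 1 + 8 * (t₆ + s * s)     ∎
  where
  open ≤-Reasoning
  a f q₆ q₇ t₆ x₆ x₇ s : ℕ
  a = sumOddSquares (7 + t)
  f = oddSquare (7 + t)
  q₆ = pairedOddSquares (6 + t)
  q₇ = pairedOddSquares (7 + t)
  t₆ = sumSquares (6 + t)
  x₆ = oddSquare ⌊ 6 + t /2⌋
  x₇ = oddSquare ⌊ 7 + t /2⌋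
  s = 7 + t
  regroup₁ : ∀ x y → (x + y) + (x + y) ≡ (x + x) + 2 * y
  regroup₁ = solve-∀
  regroup₂ : ∀ p q r x y z → (p + q + 1 + 8 * r) + (x + y + 8 * z) ≡ (p + x) + (q + y) + 1 + 8 * (r + z)
  regroup₂ = solve-∀
  quadratic : ∀ x → 2 * (suc (2 * (7 + x)) * suc (2 * (7 + x))) + (2 * (x * x) + 18 * x + 27)
                    ≡ (6 + x) * (6 + x) + (7 + x) * (7 + x) + 8 * ((7 + x) * (7 + x))
  quadratic = solve-∀
  step : 2 * f ≤ x₆ + x₇ + 8 * (s * s)
  step = ≤-trans (m≤m+n (2 * f) _) (≤-trans (≤-reflexive (quadratic t))
           (+-monoˡ-≤ (8 * (s * s)) (+-mono-≤ (i*i≤oddSquare⌊i/2⌋ (6 + t)) (i*i≤oddSquare⌊i/2⌋ (7 + t)))))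

exactCoverFeasible⇒k≤5 : ∀ k → ExactCoverFeasible k (sumSquares k) → k ≤ 5
exactCoverFeasible⇒k≤5 k feasible with k ≤? 5
... | yes k≤5 = k≤5
... | no  k≰5 = contradiction (subst (λ k → ExactCoverFeasible k (sumSquares k)) (sym k≡) feasible)
                             (<⇒≱ (exactCover-infeasible-6+ (k ∸ 6)))
  where
  k≡ : 6 + (k ∸ 6) ≡ k
  k≡ = m+[n∸m]≡n (≰⇒> k≰5)

-- Partial injections

occurs : Maybe ℕ → ℕ → ℕ
occurs x ℓ = maybe′ (λ s → 𝟙 (ℓ ≟ s)) 0 x

occurs≤1 : ∀ x ℓ → occurs x ℓ ≤ 1
occurs≤1 nothing  ℓ = z≤n
occurs≤1 (just s) ℓ = 𝟙≤1 (ℓ ≟ s)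

1≤occurs⇒ : ∀ x ℓ → 1 ≤ occurs x ℓ → x ≡ just ℓ
1≤occurs⇒ (just s) ℓ 1≤o = cong just (sym (1≤𝟙⇒ (ℓ ≟ s) 1≤o))

∑-occurs : ∀ K (h : ℕ → ℕ) x → (∀ {s} → x ≡ just s → s < K) → ∑[ ℓ < K ] (occurs x ℓ * h ℓ) ≡ maybe′ h 0 x
∑-occurs K h nothing  _     = ∑-zero K
∑-occurs K h (just s) bound = ∑-point< K h (bound refl)

labelSquare : Maybe ℕ → ℕ
labelSquare = maybe′ (λ s → suc s * suc s) 0

module PartialInjection (n : ℕ) (G : ℕ → Maybe ℕ)
  (G-injective : ∀ {v w s} → v < n → w < n → G v ≡ just s → G w ≡ just s → v ≡ w) where

  multiplicity : ℕ → ℕ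
  multiplicity ℓ = ∑[ v < n ] occurs (G v) ℓ

  multiplicity≤1 : ∀ ℓ → multiplicity ℓ ≤ 1
  multiplicity≤1 ℓ = ∑-≤1 n (λ v → occurs (G v) ℓ) (λ v _ → occurs≤1 (G v) ℓ)
    λ v w v<n w<n 1≤ov 1≤ow → G-injective v<n w<n (1≤occurs⇒ (G v) ℓ 1≤ov) (1≤occurs⇒ (G w) ℓ 1≤ow)

  occurs≡𝟙 : ∀ {c ℓ} → c < n → G c ≡ just ℓ → ∀ v → v < n → occurs (G v) ℓ ≡ 𝟙 (v ≟ c)
  occurs≡𝟙 {c} {ℓ} c<n Gc v v<n with v ≟ c
  ... | yes refl = trans (cong (λ x → occurs x ℓ) Gc) (𝟙-yes (ℓ ≟ ℓ) refl)
  ... | no  v≢c  = n≤0⇒n≡0 (≮⇒≥ λ 1≤o → v≢c (G-injective v<n c<n (1≤occurs⇒ (G v) ℓ 1≤o) Gc))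

  ∑-at-preimage : ∀ {c ℓ} (H : ℕ → ℕ) → c < n → G c ≡ just ℓ → ∑[ v < n ] (occurs (G v) ℓ * H v) ≡ H c
  ∑-at-preimage H c<n Gc = trans (∑-cong n λ v v<n → cong (_* H v) (occurs≡𝟙 c<n Gc v v<n)) (∑-point< n H c<n)

  module Bounded (K : ℕ) (G<K : ∀ {v s} → v < n → G v ≡ just s → s < K) where

    ∑-reindex : ∀ (F : ℕ → ℕ → ℕ) →
                ∑[ v < n ] maybe′ (F v) 0 (G v) ≡ ∑[ ℓ < K ] ∑[ v < n ] (occurs (G v) ℓ * F v ℓ)
    ∑-reindex F = trans (∑-cong n λ v v<n → sym (∑-occurs K (F v) (G v) (G<K v<n))) (∑-comm n K _)

    ∑-multiplicity : ∀ (h : ℕ → ℕ) → ∑[ v < n ] maybe′ h 0 (G v) ≡ ∑[ ℓ < K ] (multiplicity ℓ * h ℓ)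
    ∑-multiplicity h = trans (∑-reindex (λ _ → h)) (∑-cong K λ ℓ _ → ∑-*ʳ n (h ℓ) (λ v → occurs (G v) ℓ))

    ∑-multiplicity-1 : ∑[ v < n ] 𝟙just (G v) ≡ ∑ K multiplicity
    ∑-multiplicity-1 = trans (∑-multiplicity (λ _ → 1)) (∑-cong K λ ℓ _ → *-identityʳ (multiplicity ℓ))

    sumSquares≤∑labelSquare : sumSquares (∑[ v < n ] 𝟙just (G v)) ≤ ∑[ v < n ] labelSquare (G v)
    sumSquares≤∑labelSquare =
      subst₂ (λ a b → sumSquares a ≤ b) (sym ∑-multiplicity-1) (sym (∑-multiplicity (λ s → suc s * suc s)))
      (∑-packing 1 K multiplicity square square (λ ℓ _ → multiplicity≤1 ℓ)
        (λ b k k< → let h = subst (k <_) (*-identityˡ (suc b)) k< in *-mono-≤ h h))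
      where
      square : ℕ → ℕ
      square j = suc j * suc j

    preimage : ∑[ v < n ] 𝟙just (G v) ≡ K → ∀ ℓ → ℓ < K → ∃ λ c → c < n × G c ≡ just ℓ
    preimage count≡K ℓ ℓ<K with ∑-positive n (λ v → occurs (G v) ℓ) (≤-reflexive (sym multiplicity≡1))
      where
      multiplicity≡1 : multiplicity ℓ ≡ 1
      multiplicity≡1 = ∑-pointwise-antisym K (λ ℓ _ → multiplicity≤1 ℓ)
        (≤-reflexive (trans (trans (∑-const K 1) (*-identityʳ K)) (sym (trans (sym ∑-multiplicity-1) count≡K)))) ℓ ℓ<K
    ... | c , c<n , 1≤o = c , c<n , 1≤occurs⇒ (G c) ℓ 1≤o

without : ℕ → (ℕ → Maybe ℕ) → ℕ → Maybe ℕ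
without v₁ G v with v ≟ v₁
... | yes _ = nothing
... | no  _ = G v

without≡just⇒ : ∀ v₁ G v {s} → without v₁ G v ≡ just s → G v ≡ just s
without≡just⇒ v₁ G v eq with v ≟ v₁
... | no _ = eq

without-≢ : ∀ v₁ G {v} → v ≢ v₁ → without v₁ G v ≡ G v
without-≢ v₁ G {v} v≢v₁ with v ≟ v₁
... | yes v≡v₁ = contradiction v≡v₁ v≢v₁
... | no  _    = refl

without-self : ∀ v₁ G → without v₁ G v₁ ≡ nothing
without-self v₁ G with v₁ ≟ v₁
... | yes _    = refl
... | no  v≢v₁ = contradiction refl v≢v₁

sumSquares-without : ∀ n (G : ℕ → Maybe ℕ)
  (G-injective : ∀ {v w s} → v < n → w < n → G v ≡ just s → G w ≡ just s → v ≡ w)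
  K (G<K : ∀ {v s} → v < n → G v ≡ just s → s < K) {v₁ s₁} → v₁ < n → G v₁ ≡ just s₁ →
  sumSquares (∑[ v < n ] 𝟙just (G v) ∸ 1) + suc s₁ * suc s₁ ≤ ∑[ v < n ] labelSquare (G v)
sumSquares-without n G G-injective K G<K {v₁} {s₁} v₁<n Gv₁ = begin
  sumSquares (∑[ v < n ] 𝟙just (G v) ∸ 1) + suc s₁ * suc s₁
    ≡⟨ cong (λ c → sumSquares (c ∸ 1) + suc s₁ * suc s₁) (removed 𝟙just refl) ⟩
  sumSquares (∑[ v < n ] 𝟙just (G′ v) + 1 ∸ 1) + suc s₁ * suc s₁
    ≡⟨ cong (λ c → sumSquares c + suc s₁ * suc s₁) (m+n∸n≡m (∑[ v < n ] 𝟙just (G′ v)) 1) ⟩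
  sumSquares (∑[ v < n ] 𝟙just (G′ v)) + suc s₁ * suc s₁
    ≤⟨ +-monoˡ-≤ (suc s₁ * suc s₁) (PartialInjection.Bounded.sumSquares≤∑labelSquare n G′ G′-injective K G′<K) ⟩
  ∑[ v < n ] labelSquare (G′ v) + suc s₁ * suc s₁
    ≡⟨ removed labelSquare refl ⟨
  ∑[ v < n ] labelSquare (G v) ∎
  where
  open ≤-Reasoning
  G′ : ℕ → Maybe ℕ
  G′ = without v₁ G
  G′-injective : ∀ {v w s} → v < n → w < n → G′ v ≡ just s → G′ w ≡ just s → v ≡ w
  G′-injective v<n w<n G′v G′w = G-injective v<n w<n (without≡just⇒ v₁ G _ G′v) (without≡just⇒ v₁ G _ G′w)
  G′<K : ∀ {v s} → v < n → G′ v ≡ just s → s < K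
  G′<K v<n G′v = G<K v<n (without≡just⇒ v₁ G _ G′v)
  removed : ∀ (f : Maybe ℕ → ℕ) → f nothing ≡ 0 → ∑[ v < n ] f (G v) ≡ ∑[ v < n ] f (G′ v) + f (just s₁)
  removed f f0 = begin-equality
    ∑[ v < n ] f (G v)                         ≡⟨ +-identityʳ _ ⟨
    ∑[ v < n ] f (G v) + 0                     ≡⟨ cong (∑[ v < n ] f (G v) +_) (trans (sym f0) (cong f (sym (without-self v₁ G)))) ⟩
    ∑[ v < n ] f (G v) + f (G′ v₁)             ≡⟨ ∑-except n (λ v → f (G v)) (λ v → f (G′ v)) v₁<n
                                                    (λ v _ v≢v₁ → cong f (sym (without-≢ v₁ G v≢v₁))) ⟩
    ∑[ v < n ] f (G′ v) + f (G v₁)             ≡⟨ cong (λ x → ∑[ v < n ] f (G′ v) + f x) Gv₁ ⟩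
    ∑[ v < n ] f (G′ v) + f (just s₁)          ∎

-- Domination by a single labelled vertex

-- The factor 𝟙 (suc s ≤? v) discards the truncated value v ∸ suc s when v < suc s.
hits : Maybe ℕ → ℕ → ℕ → ℕ
hits nothing        v u = 0
hits (just zero)    v u = 𝟙 (u ≟ v)
hits (just (suc s)) v u = 𝟙 (suc s ≤? v) * 𝟙 (u ≟ v ∸ suc s) + 𝟙 (u ≟ v + suc s)

dominatedWeight : ℕ → (ℕ → ℕ) → Maybe ℕ → ℕ → ℕ
dominatedWeight n h nothing        v = 0
dominatedWeight n h (just zero)    v = h v
dominatedWeight n h (just (suc s)) v = 𝟙 (suc s ≤? v) * h (v ∸ suc s) + 𝟙 (v + suc s <? n) * h (v + suc s)

∑-hits : ∀ n (h : ℕ → ℕ) x {v} → v < n → ∑[ u < n ] (hits x v u * h u) ≡ dominatedWeight n h x v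
∑-hits n h nothing        v<n = ∑-zero n
∑-hits n h (just zero)    v<n = ∑-point< n h v<n
∑-hits n h (just (suc s)) {v} v<n = begin
  ∑[ u < n ] ((a * 𝟙 (u ≟ v ∸ t) + 𝟙 (u ≟ v + t)) * h u)
    ≡⟨ ∑-cong n (λ u _ → distrib a (𝟙 (u ≟ v ∸ t)) (𝟙 (u ≟ v + t)) (h u)) ⟩
  ∑[ u < n ] (a * (𝟙 (u ≟ v ∸ t) * h u) + 𝟙 (u ≟ v + t) * h u)
    ≡⟨ ∑-+ n (λ u → a * (𝟙 (u ≟ v ∸ t) * h u)) (λ u → 𝟙 (u ≟ v + t) * h u) ⟩
  ∑[ u < n ] (a * (𝟙 (u ≟ v ∸ t) * h u)) + ∑[ u < n ] (𝟙 (u ≟ v + t) * h u)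
    ≡⟨ cong₂ _+_ (trans (∑-*ˡ n a _) (cong (a *_) (∑-point< n h (≤-<-trans (m∸n≤m v t) v<n))))
                 (∑-point n (v + t) h) ⟩
  a * h (v ∸ t) + 𝟙 (v + t <? n) * h (v + t) ∎
  where
  open ≡-Reasoning
  t a : ℕ
  t = suc s
  a = 𝟙 (t ≤? v)
  distrib : ∀ a b c x → (a * b + c) * x ≡ a * (b * x) + c * x
  distrib = solve-∀

hits-distance : ∀ s u v → ∣ u - v ∣ ≡ suc s → 1 ≤ hits (just (suc s)) v u
hits-distance s u v d with ≤-total u v
... | inj₁ u≤v = ≤-trans (≤-reflexive (sym (*-identityʳ 1))) (≤-trans (*-mono-≤ below left) (m≤m+n _ _))
  where
  v∸u≡ : v ∸ u ≡ suc s
  v∸u≡ = trans (sym (m≤n⇒∣m-n∣≡n∸m u≤v)) d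
  below : 1 ≤ 𝟙 (suc s ≤? v)
  below = ≤-reflexive (sym (𝟙-yes (suc s ≤? v) (subst (_≤ v) v∸u≡ (m∸n≤m v u))))
  left : 1 ≤ 𝟙 (u ≟ v ∸ suc s)
  left = ≤-reflexive (sym (𝟙-yes (u ≟ v ∸ suc s) (sym (trans (cong (v ∸_) (sym v∸u≡)) (m∸[m∸n]≡n u≤v)))))
... | inj₂ v≤u = ≤-trans (≤-reflexive (sym (𝟙-yes (u ≟ v + suc s) u≡))) (m≤n+m _ _)
  where
  u≡ : u ≡ v + suc s
  u≡ = sym (trans (cong (v +_) (sym (trans (sym (m≤n⇒∣n-m∣≡n∸m v≤u)) d))) (m+[n∸m]≡n v≤u))

capacity : Maybe ℕ → ℕ
capacity nothing        = 0
capacity (just zero)    = 1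
capacity (just (suc _)) = 2

isZero : Maybe ℕ → ℕ
isZero (just zero) = 1
isZero _           = 0

isZero≤1 : ∀ x → isZero x ≤ 1
isZero≤1 (just zero)    = ≤-refl
isZero≤1 nothing        = z≤n
isZero≤1 (just (suc _)) = z≤n

capacity+isZero : ∀ x → capacity x + isZero x ≡ 2 * 𝟙just x
capacity+isZero nothing        = refl
capacity+isZero (just zero)    = refl
capacity+isZero (just (suc _)) = refl

reach : ℕ → Maybe ℕ → ℕ → ℕ
reach n x v = dominatedWeight n (λ _ → 1) x v

reach≤capacity : ∀ n x v → reach n x v ≤ capacity x
reach≤capacity n nothing        v = z≤n
reach≤capacity n (just zero)    v = ≤-refl
reach≤capacity n (just (suc s)) v =
  +-mono-≤ (≤-trans (≤-reflexive (*-identityʳ _)) (𝟙≤1 (suc s ≤? v)))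
           (≤-trans (≤-reflexive (*-identityʳ _)) (𝟙≤1 (v + suc s <? n)))

fullEntry : Maybe ℕ → ℕ → Maybe ℕ
fullEntry (just (suc s)) 2 = just s
fullEntry _              _ = nothing

-- full n x v ≡ just s records a full vertex v with label suc s (not s).
full : ℕ → Maybe ℕ → ℕ → Maybe ℕ
full n x v = fullEntry x (reach n x v)

full≡just⇒ : ∀ n x v {s} → full n x v ≡ just s → x ≡ just (suc s) × reach n x v ≡ 2
full≡just⇒ n (just (suc s)) v eq with reach n (just (suc s)) v
full≡just⇒ n (just (suc s)) v refl | 2 = refl , refl

reach≡2⇒inside : ∀ n s v → reach n (just (suc s)) v ≡ 2 → suc s ≤ v × v + suc s < n
reach≡2⇒inside n s v eq with suc s ≤? v | v + suc s <? n
... | yes below | yes above = below , above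
... | yes _     | no  _     = contradiction eq λ ()
... | no  _     | yes _     = contradiction eq λ ()
... | no  _     | no  _     = contradiction eq λ ()

full-intro : ∀ n s v → reach n (just (suc s)) v ≡ 2 → full n (just (suc s)) v ≡ just s
full-intro n s v eq = cong (fullEntry (just (suc s))) eq

pairWeight : ℕ → (ℕ → ℕ) → Maybe ℕ → ℕ → ℕ
pairWeight n h x v = maybe′ (λ s → h (v ∸ suc s) + h (v + suc s)) 0 (full n x v)

saturated-weight : ∀ n h x v → reach n x v ≡ capacity x → dominatedWeight n h x v ≡ isZero x * h v + pairWeight n h x v
saturated-weight n h nothing        v _  = refl
saturated-weight n h (just zero)    v _  = sym (trans (+-identityʳ (h v + 0)) (+-identityʳ (h v)))
saturated-weight n h (just (suc s)) v eq with reach≡2⇒inside n s v eq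
... | below , above = begin
  𝟙 (suc s ≤? v) * h (v ∸ suc s) + 𝟙 (v + suc s <? n) * h (v + suc s)
    ≡⟨ cong₂ _+_ (cong (_* h (v ∸ suc s)) (𝟙-yes (suc s ≤? v) below))
                 (cong (_* h (v + suc s)) (𝟙-yes (v + suc s <? n) above)) ⟩
  1 * h (v ∸ suc s) + 1 * h (v + suc s)
    ≡⟨ cong₂ _+_ (*-identityˡ (h (v ∸ suc s))) (*-identityˡ (h (v + suc s))) ⟩
  h (v ∸ suc s) + h (v + suc s)
    ≡⟨ cong (maybe′ (λ s → h (v ∸ suc s) + h (v + suc s)) 0) (full-intro n s v eq) ⟨
  pairWeight n h (just (suc s)) v ∎
  where open ≡-Reasoning

saturated-𝟙just : ∀ n x v → reach n x v ≡ capacity x → 𝟙just x ≡ isZero x + 𝟙just (full n x v)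
saturated-𝟙just n nothing        v _  = refl
saturated-𝟙just n (just zero)    v _  = refl
saturated-𝟙just n (just (suc s)) v eq = cong 𝟙just (sym (full-intro n s v eq))

reach≡1⇒single : ∀ n s {v} → reach n (just (suc s)) v ≡ 1 →
  ∃ λ w → ∣ w - v ∣ ≡ suc s × (∀ h → dominatedWeight n h (just (suc s)) v ≡ h w)
reach≡1⇒single n s {v} eq with suc s ≤? v | v + suc s <? n
... | yes below | no  _     = v ∸ suc s ,
  trans (m≤n⇒∣m-n∣≡n∸m (m∸n≤m v (suc s))) (m∸[m∸n]≡n below) ,
  λ h → trans (+-identityʳ (1 * h (v ∸ suc s))) (*-identityˡ (h (v ∸ suc s)))
... | no  _     | yes above = v + suc s , trans (∣-∣-comm (v + suc s) v) (∣m-m+n∣≡n v (suc s)) ,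
  λ h → *-identityˡ (h (v + suc s))
... | yes _     | yes _     = contradiction eq λ ()
... | no  _     | no  _     = contradiction eq λ ()

slack≡1⇒ : ∀ n x v → capacity x ∸ reach n x v ≡ 1 → ∃ λ s → x ≡ just (suc s) × reach n x v ≡ 1
slack≡1⇒ n (just (suc s)) v eq = s , refl , lemma (reach n (just (suc s)) v) (reach≤capacity n (just (suc s)) v) eq
  where
  lemma : ∀ r → r ≤ 2 → 2 ∸ r ≡ 1 → r ≡ 1
  lemma 1 _ _ = refl
  lemma 2 _ ()
  lemma (suc (suc (suc _))) (s≤s (s≤s ())) _

-- Labellings of the path as functions on ℕ

labelAt : ∀ {n} → Labelling n → ℕ → Maybe ℕ
labelAt {n} λ' i with i <? n
... | yes i<n = λ' (fromℕ< i<n)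
... | no  _   = nothing

labelAt-toℕ : ∀ {n} (λ' : Labelling n) (i : Fin n) → labelAt λ' (toℕ i) ≡ λ' i
labelAt-toℕ {n} λ' i with toℕ i <? n
... | yes i<n = cong λ' (fromℕ<-toℕ i i<n)
... | no  i≮n = contradiction (toℕ<n i) i≮n

labelAt-fromℕ< : ∀ {n} (λ' : Labelling n) {i} (i<n : i < n) → labelAt λ' i ≡ λ' (fromℕ< i<n)
labelAt-fromℕ< λ' i<n = trans (cong (labelAt λ') (sym (toℕ-fromℕ< i<n))) (labelAt-toℕ λ' (fromℕ< i<n))

length-filterᵇ-tabulate : ∀ {A : Set} n (p : A → Bool) (f : Fin n → A) (g : ℕ → ℕ) →
  (∀ i → g (toℕ i) ≡ (if p (f i) then 1 else 0)) → length (filterᵇ p (tabulate f)) ≡ ∑ n g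
length-filterᵇ-tabulate zero    p f g eq = refl
length-filterᵇ-tabulate (suc n) p f g eq with p (f Fin.zero) in p0 | eq Fin.zero
... | true  | g0≡1 = trans (cong suc (length-filterᵇ-tabulate n p (f ∘ Fin.suc) (g ∘ suc) (eq ∘ Fin.suc)))
                            (trans (cong (_+ ∑[ i < n ] g (suc i)) (sym g0≡1)) (sym (∑-head n g)))
... | false | g0≡0 = trans (length-filterᵇ-tabulate n p (f ∘ Fin.suc) (g ∘ suc) (eq ∘ Fin.suc))
                            (trans (cong (_+ ∑[ i < n ] g (suc i)) (sym g0≡0)) (sym (∑-head n g)))

card≡∑𝟙just : ∀ {n} (λ' : Labelling n) → card λ' ≡ ∑[ v < n ] 𝟙just (labelAt λ' v)
card≡∑𝟙just {n} λ' = length-filterᵇ-tabulate n (λ v → is-just (λ' v)) id (λ v → 𝟙just (labelAt λ' v))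
  λ i → trans (cong 𝟙just (labelAt-toℕ λ' i)) (𝟙just≡ (λ' i))
  where
  𝟙just≡ : ∀ (x : Maybe ℕ) → 𝟙just x ≡ (if is-just x then 1 else 0)
  𝟙just≡ nothing  = refl
  𝟙just≡ (just _) = refl

-- Balanced placements of the labels 1, …, k

-- cs lists the full vertices with labels k, …, 1 (head first), z is the vertex labelled 0 and w the
-- vertex dominated by the remaining labelled vertex, which must lie at distance > k from w.
square : ℕ → ℕ
square x = x * x

pairSum : ∀ {k} → Vec ℕ k → (ℕ → ℕ) → ℕ
pairSum []                 h = 0
pairSum {suc k} (c ∷ cs) h = pairSum cs h + (h (c ∸ suc k) + h (c + suc k))

Admissible : ∀ {k} → ℕ → Vec ℕ k → Set
Admissible         n []       = ⊤
Admissible {suc k} n (c ∷ cs) = (suc k ≤ c × c + suc k < n) × Admissible n cs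

allBelow : ℕ → (ℕ → Bool) → Bool
allBelow zero    p = true
allBelow (suc n) p = p n ∧ allBelow n p

allBelow-sound : ∀ n p → T (allBelow n p) → ∀ {x} → x < n → T (p x)
allBelow-sound (suc n) p ok {x} x<1+n with Equivalence.to T-∧ ok | m<1+n⇒m<n∨m≡n x<1+n
... | pn , _    | inj₂ refl = pn
... | _  , rest | inj₁ x<n  = allBelow-sound n p rest x<n

allAdmissible : (k n : ℕ) → (Vec ℕ k → Bool) → Bool
allAdmissible zero    n p = p []
allAdmissible (suc k) n p =
  allBelow n λ c → not ((suc k ≤ᵇ c) ∧ (c + suc k <ᵇ n)) ∨ allAdmissible k n (λ cs → p (c ∷ cs))

allAdmissible-sound : ∀ k n (p : Vec ℕ k → Bool) → T (allAdmissible k n p) → ∀ cs → Admissible n cs → T (p cs)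
allAdmissible-sound zero    n p ok []       _                             = ok
allAdmissible-sound (suc k) n p ok (c ∷ cs) ((k<c , c+k<n) , admissible) =
  allAdmissible-sound k n (λ cs → p (c ∷ cs)) (guarded (Equivalence.from T-∧ (≤⇒≤ᵇ k<c , <⇒<ᵇ c+k<n)) c-case) cs admissible
  where
  c-case : T (not ((suc k ≤ᵇ c) ∧ (c + suc k <ᵇ n)) ∨ allAdmissible k n (λ cs → p (c ∷ cs)))
  c-case = allBelow-sound n _ ok (≤-trans (s≤s (m≤m+n c (suc k))) c+k<n)
  guarded : ∀ {a r} → T a → T (not a ∨ r) → T r
  guarded {true} _ r = r

Balanced : ∀ {k} → ℕ → Vec ℕ k → ℕ → ℕ → Set
Balanced n cs z w = ∑ n id ≡ z + w + pairSum cs id × ∑ n square ≡ square z + square w + pairSum cs square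

DistantDominator : ∀ {k} → ℕ → Vec ℕ k → ℕ → ℕ → Set
DistantDominator {k} n cs z w = ∃ λ v → v < n × All (v ≢_) (z ∷ cs) × suc k ≤ ∣ w - v ∣

complement : ∀ {k} → ℕ → Vec ℕ k → ℕ → ℕ
complement n cs z = ∑ n id ∸ (z + pairSum cs id)

Candidate : ∀ {k} → ℕ → Vec ℕ k → ℕ → ℕ → Set
Candidate n cs z w = Balanced n cs z w × Unique (z ∷ cs) × DistantDominator n cs z w

candidate? : ∀ {k} n (cs : Vec ℕ k) z w → Dec (Candidate n cs z w)
candidate? {k} n cs z w =
  ((∑ n id ≟ z + w + pairSum cs id) ×-dec (∑ n square ≟ square z + square w + pairSum cs square))
  ×-dec allPairs? (λ x y → ¬? (x ≟ y)) (z ∷ cs)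
  ×-dec anyUpTo? (λ v → allᵥ? (λ x → ¬? (v ≟ x)) (z ∷ cs) ×-dec (suc k ≤? ∣ w - v ∣)) n

Refuted : ℕ → ℕ → Set
Refuted k n = ∀ (cs : Vec ℕ k) → Admissible n cs → ∀ {z} → z < n → ¬ Candidate n cs z (complement n cs z)

noCandidateAt : ∀ {k} n (cs : Vec ℕ k) → ℕ → Bool
noCandidateAt n cs z = not (isYes (candidate? n cs z (complement n cs z)))

refuted : ∀ k n → T (allAdmissible k n λ cs → allBelow n (noCandidateAt n cs)) → Refuted k n
refuted k n ok cs admissible z<n = toWitnessFalse
  (allBelow-sound n (noCandidateAt n cs) (allAdmissible-sound k n (λ cs → allBelow n (noCandidateAt n cs)) ok cs admissible) z<n)

centres : (ℕ → ℕ) → ∀ k → Vec ℕ k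
centres c zero    = []
centres c (suc k) = c k ∷ centres c k

pairSum-centres : ∀ c k (h : ℕ → ℕ) → pairSum (centres c k) h ≡ ∑[ ℓ < k ] (h (c ℓ ∸ suc ℓ) + h (c ℓ + suc ℓ))
pairSum-centres c zero    h = refl
pairSum-centres c (suc k) h = cong (_+ (h (c k ∸ suc k) + h (c k + suc k))) (pairSum-centres c k h)

All-centres : ∀ {p} {P : ℕ → Set p} c k → (∀ ℓ → ℓ < k → P (c ℓ)) → All P (centres c k)
All-centres c zero    _  = []
All-centres c (suc k) Pc = Pc k ≤-refl ∷ All-centres c k λ ℓ ℓ<k → Pc ℓ (m<n⇒m<1+n ℓ<k)

Admissible-centres : ∀ n c k → (∀ ℓ → ℓ < k → suc ℓ ≤ c ℓ × c ℓ + suc ℓ < n) → Admissible n (centres c k)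
Admissible-centres n c zero    _   = tt
Admissible-centres n c (suc k) adm = adm k ≤-refl , Admissible-centres n c k λ ℓ ℓ<k → adm ℓ (m<n⇒m<1+n ℓ<k)

Unique-centres : ∀ c k → (∀ {a b} → a < k → b < k → c a ≡ c b → a ≡ b) → Unique (centres c k)
Unique-centres c zero    _   = []
Unique-centres c (suc k) inj =
  All-centres c k (λ ℓ ℓ<k ck≡cℓ → <-irrefl (sym (inj ≤-refl (m<n⇒m<1+n ℓ<k) ck≡cℓ)) ℓ<k)
  ∷ Unique-centres c k λ a<k b<k → inj (m<n⇒m<1+n a<k) (m<n⇒m<1+n b<k)

no-balanced-placement : ∀ {k n} → Refuted k n → ∀ (c : ℕ → ℕ) {z w v₀} →
  (∀ ℓ → ℓ < k → suc ℓ ≤ c ℓ × c ℓ + suc ℓ < n) → (∀ {a b} → a < k → b < k → c a ≡ c b → a ≡ b) →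
  z < n → (∀ ℓ → ℓ < k → z ≢ c ℓ) →
  (∀ h → ∑ n h ≡ h z + h w + ∑[ ℓ < k ] (h (c ℓ ∸ suc ℓ) + h (c ℓ + suc ℓ))) →
  v₀ < n → v₀ ≢ z → (∀ ℓ → ℓ < k → v₀ ≢ c ℓ) → suc k ≤ ∣ w - v₀ ∣ → ⊥
no-balanced-placement {k} {n} refutation c {z} {w} {v₀} adm inj z<n z∉c moments v₀<n v₀≢z v₀∉c far =
  refutation cs (Admissible-centres n c k adm) z<n
    (subst (Candidate n cs z) (sym w≡) (balanced , unique , distant))
  where
  cs : Vec ℕ k
  cs = centres c k
  moments′ : ∀ h → ∑ n h ≡ h z + h w + pairSum cs h
  moments′ h = trans (moments h) (cong (h z + h w +_) (sym (pairSum-centres c k h)))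
  balanced : Balanced n cs z w
  balanced = moments′ id , moments′ square
  unique : Unique (z ∷ cs)
  unique = All-centres c k z∉c ∷ Unique-centres c k inj
  distant : DistantDominator n cs z w
  distant = v₀ , v₀<n , v₀≢z ∷ All-centres c k v₀∉c , far
  w≡ : complement n cs z ≡ w
  w≡ = trans (cong (_∸ (z + pairSum cs id)) (trans (proj₁ balanced) (xy∙z≈y∙xz z w (pairSum cs id))))
             (m+n∸n≡m w (z + pairSum cs id))

-- Extended irregular dominating sets of the path

module Labelled {n} (λ' : Labelling n) (valid : IsExtIrrDom λ') where
  open IsExtIrrDom valid

  L : ℕ → Maybe ℕ
  L = labelAt λ'

  L-injective : ∀ {v w ℓ} → v < n → w < n → L v ≡ just ℓ → L w ≡ just ℓ → v ≡ w
  L-injective {v} {w} {ℓ} v<n w<n Lv Lw = begin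
    v                 ≡⟨ toℕ-fromℕ< v<n ⟨
    toℕ (fromℕ< v<n)  ≡⟨ cong toℕ (injective _ _ ℓ (trans (sym (labelAt-fromℕ< λ' v<n)) Lv)
                                                   (trans (sym (labelAt-fromℕ< λ' w<n)) Lw)) ⟩
    toℕ (fromℕ< w<n)  ≡⟨ toℕ-fromℕ< w<n ⟩
    w                 ∎
    where open ≡-Reasoning

  z : ℕ
  z = toℕ (proj₁ hasZero)

  z<n : z < n
  z<n = toℕ<n (proj₁ hasZero)

  Lz : L z ≡ just 0
  Lz = trans (labelAt-toℕ λ' (proj₁ hasZero)) (proj₂ hasZero)

  coverCount : ℕ → ℕ
  coverCount u = ∑[ v < n ] hits (L v) v u

  1≤coverCount : ∀ u → u < n → 1 ≤ coverCount u
  1≤coverCount u u<n with dominates (fromℕ< u<n)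
  ... | v , ℓ , λv≡ , dom =
    ≤-trans (hit ℓ (trans (labelAt-toℕ λ' v) λv≡) dom) (term≤∑ n (λ v → hits (L v) v u) (toℕ<n v))
    where
    u≡ : toℕ (fromℕ< u<n) ≡ u
    u≡ = toℕ-fromℕ< u<n
    hit : ∀ ℓ → L (toℕ v) ≡ just ℓ → Dominates ℓ v (fromℕ< u<n) → 1 ≤ hits (L (toℕ v)) (toℕ v) u
    hit zero    Lv u≡v rewrite Lv = ≤-reflexive (sym (𝟙-yes (u ≟ toℕ v) (trans (sym u≡) (cong toℕ u≡v))))
    hit (suc s) Lv d   rewrite Lv = hits-distance s u (toℕ v) (trans (cong (∣_- toℕ v ∣) (sym u≡)) d)

  ∑-coverCount-weighted : ∀ h → ∑[ u < n ] (coverCount u * h u) ≡ ∑[ v < n ] dominatedWeight n h (L v) v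
  ∑-coverCount-weighted h = begin
    ∑[ u < n ] (coverCount u * h u)                ≡⟨ ∑-cong n (λ u _ → sym (∑-*ʳ n (h u) (λ v → hits (L v) v u))) ⟩
    ∑[ u < n ] ∑[ v < n ] (hits (L v) v u * h u)   ≡⟨ ∑-comm n n (λ u v → hits (L v) v u * h u) ⟩
    ∑[ v < n ] ∑[ u < n ] (hits (L v) v u * h u)   ≡⟨ ∑-cong n (λ v v<n → ∑-hits n h (L v) v<n) ⟩
    ∑[ v < n ] dominatedWeight n h (L v) v         ∎
    where open ≡-Reasoning

  ∑coverCount≡∑reach : ∑ n coverCount ≡ ∑[ v < n ] reach n (L v) v
  ∑coverCount≡∑reach = trans (∑-cong n λ u _ → sym (*-identityʳ (coverCount u))) (∑-coverCount-weighted (λ _ → 1))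

  n≤∑coverCount : n ≤ ∑ n coverCount
  n≤∑coverCount = ≤-trans (≤-reflexive (sym (trans (∑-const n 1) (*-identityʳ n)))) (∑-mono-≤ n 1≤coverCount)

  coveredOnce⇒∑ : (∀ u → u < n → coverCount u ≡ 1) → ∀ h → ∑ n h ≡ ∑[ u < n ] (coverCount u * h u)
  coveredOnce⇒∑ once h = ∑-cong n λ u u<n → trans (sym (*-identityˡ (h u))) (cong (_* h u) (sym (once u u<n)))

  ∑reach≤∑capacity : ∑[ v < n ] reach n (L v) v ≤ ∑[ v < n ] capacity (L v)
  ∑reach≤∑capacity = ∑-mono-≤ n λ v _ → reach≤capacity n (L v) v

  isZero≡𝟙 : ∀ v → v < n → isZero (L v) ≡ 𝟙 (v ≟ z)
  isZero≡𝟙 v v<n with v ≟ z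
  ... | yes refl = cong isZero Lz
  ... | no  v≢z with L v in Lv
  ...   | nothing      = refl
  ...   | just zero    = contradiction (L-injective v<n z<n Lv Lz) v≢z
  ...   | just (suc _) = refl

  ∑isZero-weighted : ∀ h → ∑[ v < n ] (isZero (L v) * h v) ≡ h z
  ∑isZero-weighted h = trans (∑-cong n λ v v<n → cong (_* h v) (isZero≡𝟙 v v<n)) (∑-point< n h z<n)

  ∑capacity+1≡2*card : ∑[ v < n ] capacity (L v) + 1 ≡ 2 * card λ'
  ∑capacity+1≡2*card = begin
    ∑[ v < n ] capacity (L v) + 1                   ≡⟨ cong (∑[ v < n ] capacity (L v) +_) ∑isZero≡1 ⟨
    ∑[ v < n ] capacity (L v) + ∑[ v < n ] isZero (L v) ≡⟨ ∑-+ n (λ v → capacity (L v)) (λ v → isZero (L v)) ⟨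
    ∑[ v < n ] (capacity (L v) + isZero (L v))      ≡⟨ ∑-cong n (λ v _ → capacity+isZero (L v)) ⟩
    ∑[ v < n ] (2 * 𝟙just (L v))                    ≡⟨ ∑-*ˡ n 2 (λ v → 𝟙just (L v)) ⟩
    2 * ∑[ v < n ] 𝟙just (L v)                      ≡⟨ cong (2 *_) (card≡∑𝟙just λ') ⟨
    2 * card λ'                                     ∎
    where
    open ≡-Reasoning
    ∑isZero≡1 : ∑[ v < n ] isZero (L v) ≡ 1
    ∑isZero≡1 = trans (∑-cong n λ v _ → sym (*-identityʳ (isZero (L v)))) (∑isZero-weighted (λ _ → 1))

  n+1≤2*card : n + 1 ≤ 2 * card λ'
  n+1≤2*card = begin
    n + 1                              ≤⟨ +-monoˡ-≤ 1 n≤∑coverCount ⟩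
    ∑ n coverCount + 1                 ≡⟨ cong (_+ 1) ∑coverCount≡∑reach ⟩
    ∑[ v < n ] reach n (L v) v + 1     ≤⟨ +-monoˡ-≤ 1 ∑reach≤∑capacity ⟩
    ∑[ v < n ] capacity (L v) + 1      ≡⟨ ∑capacity+1≡2*card ⟩
    2 * card λ'                        ∎
    where open ≤-Reasoning

  fullAt : ℕ → Maybe ℕ
  fullAt v = full n (L v) v

  fullAt≡just⇒ : ∀ {v s} → fullAt v ≡ just s → L v ≡ just (suc s) × reach n (just (suc s)) v ≡ 2
  fullAt≡just⇒ {v} Fv with full≡just⇒ n (L v) v Fv
  ... | Lv , reach≡2 = Lv , subst (λ x → reach n x v ≡ 2) Lv reach≡2

  fullAt-inside : ∀ {v s} → fullAt v ≡ just s → suc s ≤ v × v + suc s < n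
  fullAt-inside {v} {s} Fv = reach≡2⇒inside n s v (proj₂ (fullAt≡just⇒ Fv))

  fullAt-injective : ∀ {v w s} → v < n → w < n → fullAt v ≡ just s → fullAt w ≡ just s → v ≡ w
  fullAt-injective v<n w<n Fv Fw = L-injective v<n w<n (proj₁ (fullAt≡just⇒ Fv)) (proj₁ (fullAt≡just⇒ Fw))

  fullAt<n : ∀ {v s} → v < n → fullAt v ≡ just s → s < n
  fullAt<n v<n Fv = <-≤-trans (proj₁ (fullAt-inside Fv)) (<⇒≤ v<n)

  open PartialInjection n fullAt fullAt-injective

  fullCount : ℕ
  fullCount = ∑[ v < n ] 𝟙just (fullAt v)

  sumSquares-fullCount≤ : sumSquares fullCount ≤ ∑[ v < n ] labelSquare (fullAt v)
  sumSquares-fullCount≤ = Bounded.sumSquares≤∑labelSquare n fullAt<n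

  Saturated : ℕ → Set
  Saturated v = reach n (L v) v ≡ capacity (L v)

  zeroAndPairs : (ℕ → ℕ) → ℕ → ℕ
  zeroAndPairs h v = isZero (L v) * h v + pairWeight n h (L v) v

  ∑zeroAndPairs : ∀ h → ∑ n (zeroAndPairs h) ≡ h z + ∑[ v < n ] pairWeight n h (L v) v
  ∑zeroAndPairs h = trans (∑-+ n (λ v → isZero (L v) * h v) (λ v → pairWeight n h (L v) v))
                          (cong (_+ ∑[ v < n ] pairWeight n h (L v) v) (∑isZero-weighted h))

  zeroOrFull : ℕ → ℕ
  zeroOrFull v = isZero (L v) + 𝟙just (fullAt v)

  zeroOrFull≤1 : ∀ v → zeroOrFull v ≤ 1
  zeroOrFull≤1 v = helper (fullAt v) refl
    where
    helper : ∀ y → fullAt v ≡ y → isZero (L v) + 𝟙just y ≤ 1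
    helper nothing  _  = ≤-trans (≤-reflexive (+-identityʳ _)) (isZero≤1 (L v))
    helper (just s) Fv = ≤-reflexive (cong (λ x → isZero x + 1) (proj₁ (fullAt≡just⇒ Fv)))

  ∑zeroOrFull : ∑ n zeroOrFull ≡ suc fullCount
  ∑zeroOrFull = trans (∑-+ n (λ v → isZero (L v)) (λ v → 𝟙just (fullAt v)))
                       (cong (_+ fullCount) (trans (∑-cong n λ v _ → sym (*-identityʳ (isZero (L v)))) (∑isZero-weighted (λ _ → 1))))

  ∑pairWeight-quadratic : ∀ h a → (∀ v t → t ≤ v → h (v ∸ t) + h (v + t) ≡ 2 * h v + a * (t * t)) →
    ∑[ v < n ] pairWeight n h (L v) v ≡ 2 * ∑[ v < n ] (𝟙just (fullAt v) * h v) + a * ∑[ v < n ] labelSquare (fullAt v)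
  ∑pairWeight-quadratic h a quadratic = begin
    ∑[ v < n ] pairWeight n h (L v) v
      ≡⟨ ∑-cong n (λ v _ → pointwise v (fullAt v) refl) ⟩
    ∑[ v < n ] (2 * (𝟙just (fullAt v) * h v) + a * labelSquare (fullAt v))
      ≡⟨ ∑-+ n (λ v → 2 * (𝟙just (fullAt v) * h v)) (λ v → a * labelSquare (fullAt v)) ⟩
    ∑[ v < n ] (2 * (𝟙just (fullAt v) * h v)) + ∑[ v < n ] (a * labelSquare (fullAt v))
      ≡⟨ cong₂ _+_ (∑-*ˡ n 2 (λ v → 𝟙just (fullAt v) * h v)) (∑-*ˡ n a (λ v → labelSquare (fullAt v))) ⟩
    2 * ∑[ v < n ] (𝟙just (fullAt v) * h v) + a * ∑[ v < n ] labelSquare (fullAt v) ∎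
    where
    open ≡-Reasoning
    pointwise : ∀ v y → fullAt v ≡ y →
                maybe′ (λ s → h (v ∸ suc s) + h (v + suc s)) 0 y ≡ 2 * (𝟙just y * h v) + a * labelSquare y
    pointwise v nothing  _  = sym (*-zeroʳ a)
    pointwise v (just s) Fv = trans (quadratic v (suc s) (proj₁ (fullAt-inside Fv)))
                                    (cong (λ x → 2 * x + a * (suc s * suc s)) (sym (*-identityˡ (h v))))

  module Tight (m : ℕ) (card≡ : card λ' ≡ suc m) where

    ∑capacity≡ : ∑[ v < n ] capacity (L v) ≡ suc (m + m)
    ∑capacity≡ = +-cancelʳ-≡ 1 _ _ (trans ∑capacity+1≡2*card (trans (cong (2 *_) card≡) (double m)))
      where
      double : ∀ m → 2 * suc m ≡ suc (m + m) + 1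
      double = solve-∀

    module AllSaturated (saturated : ∀ v → v < n → Saturated v) where

      weighted : ∀ h → ∑[ u < n ] (coverCount u * h u) ≡ h z + ∑[ v < n ] pairWeight n h (L v) v
      weighted h = trans (∑-coverCount-weighted h)
        (trans (∑-cong n λ v v<n → saturated-weight n h (L v) v (saturated v v<n)) (∑zeroAndPairs h))

      fullCount≡m : fullCount ≡ m
      fullCount≡m = suc-injective (begin
        suc fullCount                              ≡⟨ ∑zeroOrFull ⟨
        ∑ n zeroOrFull                             ≡⟨ ∑-cong n (λ v v<n → saturated-𝟙just n (L v) v (saturated v v<n)) ⟨
        ∑[ v < n ] 𝟙just (L v)                     ≡⟨ card≡∑𝟙just λ' ⟨
        card λ'                                    ≡⟨ card≡ ⟩
        suc m                                      ∎)
        where open ≡-Reasoning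

    module OddTight (n≡ : n ≡ suc (m + m)) where

      ∑capacity≡n : ∑[ v < n ] capacity (L v) ≡ n
      ∑capacity≡n = trans ∑capacity≡ (sym n≡)

      coveredOnce : ∀ u → u < n → coverCount u ≡ 1
      coveredOnce = ∑-positive-≤n⇒≡1 n coverCount 1≤coverCount
        (≤-trans (≤-reflexive ∑coverCount≡∑reach) (≤-trans ∑reach≤∑capacity (≤-reflexive ∑capacity≡n)))

      saturated : ∀ v → v < n → Saturated v
      saturated = ∑-pointwise-antisym n (λ v _ → reach≤capacity n (L v) v)
        (≤-trans (≤-reflexive ∑capacity≡n) (≤-trans n≤∑coverCount (≤-reflexive ∑coverCount≡∑reach)))

      open AllSaturated saturated

      h : ℕ → ℕ
      h u = distSq u m

      X Y : ℕ
      X = ∑[ v < n ] (𝟙just (fullAt v) * h v)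
      Y = ∑[ v < n ] labelSquare (fullAt v)

      identity : sumSquares m + sumSquares m ≡ h z + (2 * X + 2 * Y)
      identity = begin
        sumSquares m + sumSquares m              ≡⟨ ∑-distSq-centre m ⟨
        ∑ (suc (m + m)) h                        ≡⟨ cong (λ n → ∑ n h) n≡ ⟨
        ∑ n h                                    ≡⟨ coveredOnce⇒∑ coveredOnce h ⟩
        ∑[ u < n ] (coverCount u * h u)          ≡⟨ weighted h ⟩
        h z + ∑[ v < n ] pairWeight n h (L v) v  ≡⟨ cong (h z +_) (∑pairWeight-quadratic h 2 λ v t → distSq-parallelogram v t m) ⟩
        h z + (2 * X + 2 * Y)                    ∎
        where open ≡-Reasoning

      hz+2X≤0 : h z + 2 * X ≤ 0
      hz+2X≤0 = +-cancelʳ-≤ (2 * Y) (h z + 2 * X) 0 (begin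
        h z + 2 * X + 2 * Y             ≡⟨ +-assoc (h z) (2 * X) (2 * Y) ⟩
        h z + (2 * X + 2 * Y)           ≡⟨ identity ⟨
        sumSquares m + sumSquares m     ≤⟨ +-mono-≤ Y≥ Y≥ ⟩
        Y + Y                           ≡⟨ cong (Y +_) (+-identityʳ Y) ⟨
        2 * Y                           ∎)
        where
        open ≤-Reasoning
        Y≥ : sumSquares m ≤ Y
        Y≥ = subst (λ j → sumSquares j ≤ Y) fullCount≡m sumSquares-fullCount≤

      z≡m : z ≡ m
      z≡m = distSq≡0⇒≡ (n≤0⇒n≡0 (m+n≤o⇒m≤o (h z) hz+2X≤0))

      X≡0 : X ≡ 0
      X≡0 = n≤0⇒n≡0 (≤-trans (m≤n*m X 2) (m+n≤o⇒n≤o (h z) hz+2X≤0))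

      -- a full vertex would have h v = 0, i.e. sit at the centre m, which is z
      noFullVertex : ¬ (1 ≤ fullCount)
      noFullVertex 1≤count with ∑-positive n (λ v → 𝟙just (fullAt v)) 1≤count
      ... | v , v<n , 1≤Fv with 1≤𝟙just⇒ (fullAt v) 1≤Fv
      ...   | s , Fv = contradiction (trans (sym (proj₁ (fullAt≡just⇒ Fv))) (trans (cong L v≡z) Lz)) λ ()
        where
        hv≡0 : h v ≡ 0
        hv≡0 = trans (sym (*-identityˡ (h v)))
                     (trans (cong (λ x → 𝟙just x * h v) (sym Fv)) (∑≡0⇒≡0 n (λ v → 𝟙just (fullAt v) * h v) X≡0 v v<n))
        v≡z : v ≡ z
        v≡z = trans (distSq≡0⇒≡ hv≡0) (sym z≡m)

      m≡0 : m ≡ 0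
      m≡0 = n≤0⇒n≡0 (≮⇒≥ λ 0<m → noFullVertex (subst (1 ≤_) (sym fullCount≡m) 0<m))

  -- On 2k + 2 vertices the capacities add up to 2k + 3: either every labelled vertex is saturated and
  -- one vertex is dominated twice, or every vertex is dominated once and one labelled vertex v₀ reaches
  -- only one vertex w.
  module EvenTight (k : ℕ) (n≡ : n ≡ suc k + suc k) (card≡ : card λ' ≡ suc (suc k)) where
    open Tight (suc k) card≡

    ∑capacity≡1+n : ∑[ v < n ] capacity (L v) ≡ suc n
    ∑capacity≡1+n = trans ∑capacity≡ (cong suc (sym n≡))

    h : ℕ → ℕ
    h = gapWeight (suc k)

    ∑h : ∑ n h ≡ sumOddSquares (suc k) + sumOddSquares (suc k)
    ∑h = trans (cong (λ n → ∑ n h) n≡) (∑-gapWeight (suc k))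

    X Y : ℕ
    X = ∑[ v < n ] (𝟙just (fullAt v) * h v)
    Y = ∑[ v < n ] labelSquare (fullAt v)

    ∑pairs-h : ∑[ v < n ] pairWeight n h (L v) v ≡ 2 * X + 8 * Y
    ∑pairs-h = ∑pairWeight-quadratic h 8 (gapWeight-parallelogram (suc k))

    overcovered⇒⊥ : ∑ n coverCount ≡ suc n → ⊥
    overcovered⇒⊥ ∑≡1+n = 8*sumSquares> k (begin
      8 * sumSquares (suc k)                     ≤⟨ *-monoʳ-≤ 8 (subst (λ j → sumSquares j ≤ Y) fullCount≡m
                                                                            sumSquares-fullCount≤) ⟩
      8 * Y                                      ≤⟨ m≤n+m (8 * Y) (h z + 2 * X) ⟩
      h z + 2 * X + 8 * Y                        ≡⟨ +-assoc (h z) (2 * X) (8 * Y) ⟩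
      h z + (2 * X + 8 * Y)                      ≡⟨ trans (weighted h) (cong (h z +_) ∑pairs-h) ⟨
      ∑[ u < n ] (coverCount u * h u)            ≤⟨ ∑-excess n coverCount h (oddSquare k) 1≤coverCount ∑≡1+n
                                                      (λ u u<n → gapWeight≤ k u (subst (u <_) n≡ u<n)) ⟩
      ∑ n h + oddSquare k                        ≡⟨ cong (_+ oddSquare k) ∑h ⟩
      sumOddSquares (suc k) + sumOddSquares (suc k) + oddSquare k ∎)
      where
      open ≤-Reasoning
      saturated : ∀ v → v < n → Saturated v
      saturated = ∑-pointwise-antisym n (λ v _ → reach≤capacity n (L v) v)
        (≤-reflexive (trans ∑capacity≡1+n (trans (sym ∑≡1+n) ∑coverCount≡∑reach)))
      open AllSaturated saturated

    module ExactlyCovered (∑≡n : ∑ n coverCount ≡ n) where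

      coveredOnce : ∀ u → u < n → coverCount u ≡ 1
      coveredOnce = ∑-positive-≤n⇒≡1 n coverCount 1≤coverCount (≤-reflexive ∑≡n)

      slack : ℕ → ℕ
      slack v = capacity (L v) ∸ reach n (L v) v

      ∑slack≡1 : ∑ n slack ≡ 1
      ∑slack≡1 = +-cancelˡ-≡ n (∑ n slack) 1 (begin
        n + ∑ n slack                                  ≡⟨ cong (_+ ∑ n slack) (trans (sym ∑≡n) ∑coverCount≡∑reach) ⟩
        ∑[ v < n ] reach n (L v) v + ∑ n slack         ≡⟨ ∑-+ n (λ v → reach n (L v) v) slack ⟨
        ∑[ v < n ] (reach n (L v) v + slack v)         ≡⟨ ∑-cong n (λ v _ → m+[n∸m]≡n (reach≤capacity n (L v) v)) ⟩
        ∑[ v < n ] capacity (L v)                      ≡⟨ ∑capacity≡1+n ⟩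
        suc n                                          ≡⟨ +-comm 1 n ⟩
        n + 1                                          ∎)
        where open ≡-Reasoning

      record DeficientVertex : Set where
        field
          v₀ s₀ w    : ℕ
          v₀<n       : v₀ < n
          Lv₀        : L v₀ ≡ just (suc s₀)
          fullAt-v₀  : fullAt v₀ ≡ nothing
          distance   : ∣ w - v₀ ∣ ≡ suc s₀
          weight     : ∀ h → dominatedWeight n h (L v₀) v₀ ≡ h w
          saturated  : ∀ v → v < n → v ≢ v₀ → Saturated v

      deficient : DeficientVertex
      deficient with ∑≡1⇒unique n slack ∑slack≡1
      ... | v₀ , v₀<n , slack≡1 , others with slack≡1⇒ n (L v₀) v₀ slack≡1
      ...   | s₀ , Lv₀ , reach≡1 with reach≡1⇒single n s₀ (subst (λ x → reach n x v₀ ≡ 1) Lv₀ reach≡1)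
      ...     | w , distance , weight = record
        { v₀ = v₀ ; s₀ = s₀ ; w = w ; v₀<n = v₀<n ; Lv₀ = Lv₀
        ; fullAt-v₀ = cong₂ fullEntry Lv₀ reach≡1
        ; distance = distance
        ; weight = λ h → trans (cong (λ x → dominatedWeight n h x v₀) Lv₀) (weight h)
        ; saturated = λ v v<n v≢v₀ → ≤-antisym (reach≤capacity n (L v) v) (m∸n≡0⇒m≤n (others v v<n v≢v₀)) }

      open DeficientVertex deficient

      moments : ∀ h → ∑ n h ≡ h z + h w + ∑[ v < n ] pairWeight n h (L v) v
      moments h = begin
        ∑ n h                                          ≡⟨ coveredOnce⇒∑ coveredOnce h ⟩
        ∑[ u < n ] (coverCount u * h u)                ≡⟨ ∑-coverCount-weighted h ⟩
        ∑ n weight′                                    ≡⟨ +-identityʳ (∑ n weight′) ⟨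
        ∑ n weight′ + 0                                ≡⟨ cong (∑ n weight′ +_) v₀-unweighted ⟩
        ∑ n weight′ + zeroAndPairs h v₀                ≡⟨ ∑-except n weight′ (zeroAndPairs h) v₀<n
                                                            (λ v v<n v≢v₀ → saturated-weight n h (L v) v (saturated v v<n v≢v₀)) ⟩
        ∑ n (zeroAndPairs h) + weight′ v₀              ≡⟨ cong₂ _+_ (∑zeroAndPairs h) (weight h) ⟩
        h z + ∑[ v < n ] pairWeight n h (L v) v + h w  ≡⟨ xy∙z≈xz∙y (h z) _ (h w) ⟩
        h z + h w + ∑[ v < n ] pairWeight n h (L v) v  ∎
        where
        open ≡-Reasoning
        weight′ : ℕ → ℕ
        weight′ v = dominatedWeight n h (L v) v
        v₀-unweighted : 0 ≡ zeroAndPairs h v₀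
        v₀-unweighted = sym (cong₂ (λ x y → isZero x * h v₀ + maybe′ (λ s → h (v₀ ∸ suc s) + h (v₀ + suc s)) 0 y)
                                   Lv₀ fullAt-v₀)

      fullCount≡k : fullCount ≡ k
      fullCount≡k = suc-injective (+-cancelʳ-≡ 1 (suc fullCount) (suc k) (begin
        suc fullCount + 1                              ≡⟨ cong₂ _+_ (sym ∑zeroOrFull) (cong 𝟙just (sym Lv₀)) ⟩
        ∑ n zeroOrFull + 𝟙just (L v₀)                  ≡⟨ ∑-except n (λ v → 𝟙just (L v)) zeroOrFull v₀<n
                                                            (λ v v<n v≢v₀ → saturated-𝟙just n (L v) v (saturated v v<n v≢v₀)) ⟨
        ∑[ v < n ] 𝟙just (L v) + zeroOrFull v₀         ≡⟨ cong₂ (λ x y → ∑[ v < n ] 𝟙just (L v) + (isZero x + 𝟙just y))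
                                                                 Lv₀ fullAt-v₀ ⟩
        ∑[ v < n ] 𝟙just (L v) + 0                     ≡⟨ +-identityʳ _ ⟩
        ∑[ v < n ] 𝟙just (L v)                         ≡⟨ card≡∑𝟙just λ' ⟨
        card λ'                                        ≡⟨ card≡ ⟩
        suc (suc k)                                    ≡⟨ +-comm 1 (suc k) ⟩
        suc k + 1                                      ∎))
        where open ≡-Reasoning

      centred : ∀ (P : ℕ → ℕ) → (∀ v → v < n → P v ≤ 1) → pairedOddSquares (∑ n P) ≤ ∑[ v < n ] (P v * h v)
      centred P P≤1 = subst (λ n → pairedOddSquares (∑ n P) ≤ ∑[ v < n ] (P v * h v)) (sym n≡)
        (∑-gapWeight-≥ (suc k) P λ v v< → P≤1 v (subst (v <_) (sym n≡) v<))

      feasible : ∀ {Y′} → Y′ ≤ Y → ExactCoverFeasible k Y′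
      feasible {Y′} Y′≤Y = begin
        pairedOddSquares k + pairedOddSquares (suc k) + 1 + 8 * Y′
          ≤⟨ +-mono-≤ (+-mono-≤ (+-mono-≤ X≥ hz+X≥) (1≤gapWeight (suc k) w)) (*-monoʳ-≤ 8 Y′≤Y) ⟩
        X + (h z + X) + h w + 8 * Y                   ≡⟨ regroup X (h z) (h w) Y ⟩
        h z + h w + (2 * X + 8 * Y)                   ≡⟨ trans (moments h) (cong (h z + h w +_) ∑pairs-h) ⟨
        ∑ n h                                         ≡⟨ ∑h ⟩
        sumOddSquares (suc k) + sumOddSquares (suc k) ∎
        where
        open ≤-Reasoning
        regroup : ∀ x a b y → x + (a + x) + b + 8 * y ≡ a + b + (2 * x + 8 * y)
        regroup = solve-∀
        X≥ : pairedOddSquares k ≤ X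
        X≥ = subst (λ j → pairedOddSquares j ≤ X) fullCount≡k
               (centred (λ v → 𝟙just (fullAt v)) (λ v _ → 𝟙just≤1 (fullAt v)))
        hz+X≥ : pairedOddSquares (suc k) ≤ h z + X
        hz+X≥ = subst₂ (λ j x → pairedOddSquares j ≤ x) (trans ∑zeroOrFull (cong suc fullCount≡k)) ∑zeroOrFull-weighted
          (centred zeroOrFull (λ v _ → zeroOrFull≤1 v))
          where
          ∑zeroOrFull-weighted : ∑[ v < n ] (zeroOrFull v * h v) ≡ h z + X
          ∑zeroOrFull-weighted = trans (∑-cong n λ v _ → *-distribʳ-+ (h v) (isZero (L v)) (𝟙just (fullAt v)))
                           (trans (∑-+ n _ _) (cong (_+ X) (∑isZero-weighted h)))

      k≤5 : k ≤ 5
      k≤5 = exactCoverFeasible⇒k≤5 k (feasible (subst (λ j → sumSquares j ≤ Y) fullCount≡k sumSquares-fullCount≤))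

      module LabelsExact (infeasible : ¬ ExactCoverFeasible k (sumSquares (k ∸ 1) + suc k * suc k)) where

        -- a full vertex with label above k would push the sum of squared labels past what the moments allow
        fullAt<k : ∀ {v s} → v < n → fullAt v ≡ just s → s < k
        fullAt<k {v} {s} v<n Fv = ≰⇒> λ k≤s → infeasible (feasible (begin
          sumSquares (k ∸ 1) + suc k * suc k            ≤⟨ +-monoʳ-≤ (sumSquares (k ∸ 1)) (*-mono-≤ (s≤s k≤s) (s≤s k≤s)) ⟩
          sumSquares (k ∸ 1) + suc s * suc s            ≡⟨ cong (λ j → sumSquares (j ∸ 1) + suc s * suc s) fullCount≡k ⟨
          sumSquares (fullCount ∸ 1) + suc s * suc s    ≤⟨ sumSquares-without n fullAt fullAt-injective n fullAt<n v<n Fv ⟩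
          Y                                             ∎))
          where open ≤-Reasoning

        open Bounded k fullAt<k

        centre : ∀ ℓ → ℓ < k → ∃ λ c → c < n × fullAt c ≡ just ℓ
        centre = preimage fullCount≡k

        c : ℕ → ℕ
        c ℓ with ℓ <? k
        ... | yes ℓ<k = proj₁ (centre ℓ ℓ<k)
        ... | no  _   = 0

        c<n : ∀ {ℓ} → ℓ < k → c ℓ < n
        c<n {ℓ} ℓ<k with ℓ <? k
        ... | yes ℓ<k′ = proj₁ (proj₂ (centre ℓ ℓ<k′))
        ... | no  ℓ≮k  = contradiction ℓ<k ℓ≮k

        fullAt-c : ∀ {ℓ} → ℓ < k → fullAt (c ℓ) ≡ just ℓ
        fullAt-c {ℓ} ℓ<k with ℓ <? k
        ... | yes ℓ<k′ = proj₂ (proj₂ (centre ℓ ℓ<k′))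
        ... | no  ℓ≮k  = contradiction ℓ<k ℓ≮k

        ∑pairs≡ : ∀ h → ∑[ v < n ] pairWeight n h (L v) v ≡ ∑[ ℓ < k ] (h (c ℓ ∸ suc ℓ) + h (c ℓ + suc ℓ))
        ∑pairs≡ h = trans (∑-reindex (λ v s → h (v ∸ suc s) + h (v + suc s)))
          (∑-cong k λ ℓ ℓ<k → ∑-at-preimage (λ v → h (v ∸ suc ℓ) + h (v + suc ℓ)) (c<n ℓ<k) (fullAt-c ℓ<k))

        k≤s₀ : k ≤ s₀
        k≤s₀ = ≮⇒≥ λ s₀<k →
          contradiction (trans (sym fullAt-v₀) (trans (cong fullAt (sym (c≡v₀ s₀<k))) (fullAt-c s₀<k))) λ ()
          where
          c≡v₀ : s₀ < k → c s₀ ≡ v₀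
          c≡v₀ s₀<k = L-injective (c<n s₀<k) v₀<n (proj₁ (fullAt≡just⇒ (fullAt-c s₀<k))) Lv₀

        refuted⇒⊥ : Refuted k n → ⊥
        refuted⇒⊥ refutation = no-balanced-placement refutation c
          (λ ℓ ℓ<k → fullAt-inside (fullAt-c ℓ<k))
          (λ a<k b<k ca≡cb → just-injective (trans (sym (fullAt-c a<k)) (trans (cong fullAt ca≡cb) (fullAt-c b<k))))
          z<n
          (λ ℓ ℓ<k z≡c → contradiction (trans (sym Lz) (trans (cong L z≡c) (proj₁ (fullAt≡just⇒ (fullAt-c ℓ<k))))) λ ())
          (λ h → trans (moments h) (cong (h z + h w +_) (∑pairs≡ h)))
          v₀<n
          (λ v₀≡z → contradiction (trans (sym Lz) (trans (cong L (sym v₀≡z)) Lv₀)) λ ())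
          (λ ℓ ℓ<k v₀≡c → contradiction (trans (sym fullAt-v₀) (trans (cong fullAt v₀≡c) (fullAt-c ℓ<k))) λ ())
          (subst (suc k ≤_) (sym distance) (s≤s k≤s₀))

refuted-0-2 : Refuted 0 2
refuted-0-2 = refuted 0 2 tt

refuted-1-4 : Refuted 1 4
refuted-1-4 = refuted 1 4 tt

refuted-3-8 : Refuted 3 8
refuted-3-8 = refuted 3 8 tt

refuted-5-12 : Refuted 5 12
refuted-5-12 = refuted 5 12 tt

labelsExact⇒¬refuted : ∀ {n} (λ' : Labelling n) (valid : IsExtIrrDom λ') k (n≡ : n ≡ suc k + suc k)
  (card≡ : card λ' ≡ suc (suc k)) → ∑ n (Labelled.coverCount λ' valid) ≡ n →
  ¬ ExactCoverFeasible k (sumSquares (k ∸ 1) + suc k * suc k) → ¬ Refuted k n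
labelsExact⇒¬refuted = Labelled.EvenTight.ExactlyCovered.LabelsExact.refuted⇒⊥

exactlyCovered⇒k∈[2,4] : ∀ {n} (λ' : Labelling n) (valid : IsExtIrrDom λ') k (n≡ : n ≡ suc k + suc k)
  (card≡ : card λ' ≡ suc (suc k)) → ∑ n (Labelled.coverCount λ' valid) ≡ n → k ≡ 2 ⊎ k ≡ 4
exactlyCovered⇒k∈[2,4] λ' valid 0 refl card≡ ∑≡n =
  contradiction refuted-0-2 (labelsExact⇒¬refuted λ' valid 0 refl card≡ ∑≡n (toWitnessFalse {a? = _ ≤? _} tt))
exactlyCovered⇒k∈[2,4] λ' valid 1 refl card≡ ∑≡n =
  contradiction refuted-1-4 (labelsExact⇒¬refuted λ' valid 1 refl card≡ ∑≡n (toWitnessFalse {a? = _ ≤? _} tt))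
exactlyCovered⇒k∈[2,4] λ' valid 2 _    _     _   = inj₁ refl
exactlyCovered⇒k∈[2,4] λ' valid 3 refl card≡ ∑≡n =
  contradiction refuted-3-8 (labelsExact⇒¬refuted λ' valid 3 refl card≡ ∑≡n (toWitnessFalse {a? = _ ≤? _} tt))
exactlyCovered⇒k∈[2,4] λ' valid 4 _    _     _   = inj₂ refl
exactlyCovered⇒k∈[2,4] λ' valid 5 refl card≡ ∑≡n =
  contradiction refuted-5-12 (labelsExact⇒¬refuted λ' valid 5 refl card≡ ∑≡n (toWitnessFalse {a? = _ ≤? _} tt))
exactlyCovered⇒k∈[2,4] λ' valid k@(suc (suc (suc (suc (suc (suc _)))))) n≡ card≡ ∑≡n =
  contradiction (Labelled.EvenTight.ExactlyCovered.k≤5 λ' valid k n≡ card≡ ∑≡n) (<⇒≱ (m≤m+n 6 _))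

even-or-odd : ∀ n → ∃ λ m → n ≡ m + m ⊎ n ≡ suc (m + m)
even-or-odd zero = 0 , inj₁ refl
even-or-odd (suc n) with even-or-odd n
... | m , inj₁ n≡ = m , inj₂ (cong suc n≡)
... | m , inj₂ n≡ = suc m , inj₁ (trans (cong suc n≡) (sym (+-suc (suc m) m)))

ceilHalfSucc-even : ∀ m → ceilHalfSucc (m + m) ≡ suc m
ceilHalfSucc-even m = trans (cong (_/ 2) (double m)) (m*n/n≡m (suc m) 2)
  where
  double : ∀ m → m + m + 2 ≡ suc m * 2
  double = solve-∀

ceilHalfSucc-odd : ∀ m → ceilHalfSucc (suc (m + m)) ≡ suc m
ceilHalfSucc-odd m = trans (cong (_/ 2) (double m)) (trans (+-distrib-/ (suc m * 2) 1 remainders)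
                     (trans (cong (_+ 0) (m*n/n≡m (suc m) 2)) (+-identityʳ (suc m))))
  where
  double : ∀ m → suc (m + m) + 2 ≡ suc m * 2 + 1
  double = solve-∀
  remainders : (suc m * 2) % 2 + 1 % 2 < 2
  remainders = subst (λ r → r + 1 % 2 < 2) (sym (m*n%n≡0 (suc m) 2)) ≤-refl

ceilHalfSucc≤ : ∀ n c → n + 1 ≤ 2 * c → ceilHalfSucc n ≤ c
ceilHalfSucc≤ n c le =
  ≤-pred (m<n*o⇒m/o<n (≤-trans (s≤s (≤-trans (≤-reflexive (regroup n)) (+-monoˡ-≤ 1 le))) (≤-reflexive (double c))))
  where
  regroup : ∀ n → n + 2 ≡ n + 1 + 1
  regroup = solve-∀
  double : ∀ c → suc (2 * c + 1) ≡ suc c * 2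
  double = solve-∀

ceilHalfSucc≤card : ∀ {n} (λ' : Labelling n) → IsExtIrrDom λ' → ceilHalfSucc n ≤ card λ'
ceilHalfSucc≤card {n} λ' valid = ceilHalfSucc≤ n (card λ') (Labelled.n+1≤2*card λ' valid)

evenTight⇒k∈[2,4] : ∀ {n} (λ' : Labelling n) (valid : IsExtIrrDom λ') k →
                    n ≡ suc k + suc k → card λ' ≡ suc (suc k) → k ≡ 2 ⊎ k ≡ 4
evenTight⇒k∈[2,4] {n} λ' valid k n≡ card≡ =
  [ (λ ∑<1+n → exactlyCovered⇒k∈[2,4] λ' valid k n≡ card≡ (≤-antisym (≤-pred ∑<1+n) n≤∑coverCount))
  , (λ ∑≡1+n → contradiction ∑≡1+n overcovered⇒⊥) ]′ (m≤n⇒m<n∨m≡n ∑≤1+n)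
  where
  open Labelled λ' valid
  open EvenTight k n≡ card≡
  ∑≤1+n : ∑ n coverCount ≤ suc n
  ∑≤1+n = ≤-trans (≤-reflexive ∑coverCount≡∑reach) (≤-trans ∑reach≤∑capacity (≤-reflexive ∑capacity≡1+n))

tight⇒n∈[1,6,10] : ∀ n (λ' : Labelling n) → IsExtIrrDom λ' → 1 ≤ n → card λ' ≡ ceilHalfSucc n →
                   n ≡ 1 ⊎ n ≡ 6 ⊎ n ≡ 10
tight⇒n∈[1,6,10] n λ' valid 1≤n card≡ = byParity (even-or-odd n)
  where
  sixOrTen : ∀ {k} → n ≡ suc k + suc k → k ≡ 2 ⊎ k ≡ 4 → n ≡ 6 ⊎ n ≡ 10
  sixOrTen n≡ (inj₁ refl) = inj₁ n≡
  sixOrTen n≡ (inj₂ refl) = inj₂ n≡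
  byParity : (∃ λ m → n ≡ m + m ⊎ n ≡ suc (m + m)) → n ≡ 1 ⊎ n ≡ 6 ⊎ n ≡ 10
  byParity (m , inj₂ n≡) = inj₁ (trans n≡ (cong (λ j → suc (j + j)) m≡0))
    where
    m≡0 : m ≡ 0
    m≡0 = Labelled.Tight.OddTight.m≡0 λ' valid m
            (trans card≡ (trans (cong ceilHalfSucc n≡) (ceilHalfSucc-odd m))) n≡
  byParity (zero  , inj₁ n≡) = contradiction (subst (1 ≤_) n≡ 1≤n) λ ()
  byParity (suc k , inj₁ n≡) = inj₂ (sixOrTen n≡
    (evenTight⇒k∈[2,4] λ' valid k n≡ (trans card≡ (trans (cong ceilHalfSucc n≡) (ceilHalfSucc-even (suc k))))))

-- Deciding extended irregular domination

dominates? : ∀ {n} ℓ (v u : Fin n) → Dec (Dominates ℓ v u)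
dominates? zero    v u = u Fin.≟ v
dominates? (suc ℓ) v u = dist u v ≟ suc ℓ

labelledDominator? : ∀ {n} (x : Maybe ℕ) (v u : Fin n) → Dec (∃[ ℓ ] (x ≡ just ℓ × Dominates ℓ v u))
labelledDominator? nothing  v u = no λ { (_ , () , _) }
labelledDominator? (just ℓ) v u = map′ (λ d → ℓ , refl , d) (λ { (_ , refl , d) → d }) (dominates? ℓ v u)

SameLabel : Maybe ℕ → Maybe ℕ → Set
SameLabel (just a) (just b) = a ≡ b
SameLabel _        _        = ⊥

sameLabel? : ∀ x y → Dec (SameLabel x y)
sameLabel? (just a) (just b) = a ≟ b
sameLabel? nothing  _        = no λ ()
sameLabel? (just _) nothing  = no λ ()

sameLabel⇒just : ∀ x y → SameLabel x y → ∃[ ℓ ] (x ≡ just ℓ × y ≡ just ℓ)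
sameLabel⇒just (just a) (just .a) refl = a , refl , refl

isExtIrrDom? : ∀ {n} (λ' : Labelling n) → Dec (IsExtIrrDom λ')
isExtIrrDom? {n} λ' = map′ toRecord fromRecord
  (  (all? λ u → all? λ v → sameLabel? (λ' u) (λ' v) →-dec u Fin.≟ v)
  ×-dec (any? λ v → ≡-decᴹ _≟_ (λ' v) (just 0))
  ×-dec (all? λ u → any? λ v → labelledDominator? (λ' v) v u))
  where
  Unfolded : Set
  Unfolded = (∀ (u v : Fin n) → SameLabel (λ' u) (λ' v) → u ≡ v)
           × (∃[ v ] (λ' v ≡ just 0))
           × (∀ u → ∃[ v ] ∃[ ℓ ] (λ' v ≡ just ℓ × Dominates ℓ v u))
  toRecord : Unfolded → IsExtIrrDom λ'
  toRecord (inj , hasZero , dom) = record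
    { injective = λ u v ℓ eu ev → inj u v (subst₂ SameLabel (sym eu) (sym ev) refl)
    ; hasZero   = hasZero
    ; dominates = dom }
  fromRecord : IsExtIrrDom λ' → Unfolded
  fromRecord R = (λ u v same → let (ℓ , eu , ev) = sameLabel⇒just (λ' u) (λ' v) same in injective u v ℓ eu ev)
               , hasZero , dominates
    where open IsExtIrrDom R

labelling1 : Labelling 1
labelling1 = lookup (just 0 ∷ [])

labelling6 : Labelling 6
labelling6 = lookup (nothing ∷ just 0 ∷ just 2 ∷ nothing ∷ just 1 ∷ just 3 ∷ [])

labelling10 : Labelling 10
labelling10 = lookup (nothing ∷ nothing ∷ nothing ∷ just 2 ∷ just 4 ∷ just 1 ∷ just 3 ∷ just 0 ∷ nothing ∷ just 7 ∷ [])

labelling1-valid : IsExtIrrDom labelling1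
labelling1-valid = toWitness {a? = isExtIrrDom? labelling1} tt

labelling6-valid : IsExtIrrDom labelling6
labelling6-valid = toWitness {a? = isExtIrrDom? labelling6} tt

labelling10-valid : IsExtIrrDom labelling10
labelling10-valid = toWitness {a? = isExtIrrDom? labelling10} tt

optimal : ∀ {n} (λ' : Labelling n) → IsExtIrrDom λ' → card λ' ≡ ceilHalfSucc n → γe≡ n (ceilHalfSucc n)
optimal λ' valid card≡ = (λ' , valid , card≡) , λ μ → ceilHalfSucc≤card μ

theorem5p7 : (n : ℕ) → 1 ≤ n →
    (γe≡ n (ceilHalfSucc n) ⇔ (n ≡ 1 ⊎ n ≡ 6 ⊎ n ≡ 10))
theorem5p7 n 1≤n = mk⇔
  (λ ((λ' , valid , card≡) , _) → tight⇒n∈[1,6,10] n λ' valid 1≤n card≡)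
  λ { (inj₁ refl)        → optimal labelling1 labelling1-valid refl
    ; (inj₂ (inj₁ refl)) → optimal labelling6 labelling6-valid refl
    ; (inj₂ (inj₂ refl)) → optimal labelling10 labelling10-valid refl }
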